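{- Let $n\ge 2$ and $r\ge1$ be integers and $p$ a positive divisor of $r$ with $\gcd(n,p,r/p)=1$. Then there exists an integer $\alpha$ with $0\le\alpha<r/p$ such that the sequence $\mathbf u=(u_{n-1},u_{n-2},\dots,u_0)$ is a perfect basis for $G(r,p,n)$, where $u_i=(\bar c_i;t_i)$ with $t_0=\mathrm{id}$, $t_i=s_is_{i-1}\cdots s_1$ for $1\le i\le n-1$ ($s_j=(j,j+1)$), $\bar c_i=(1,0,\dots,0,\alpha p-1)\in\mathbf Z_r^n$ for $0\le i\le n-2$, and $\bar c_{n-1}=(1,0,\dots,0,p-1)\in\mathbf Z_r^n$.
   Context: $G(r,n)$ is the set of pairs $((c_1,\dots,c_n);\pi)$, $c_i\in\mathbf Z_r=\mathbf Z/r\mathbf Z$, $\pi\in S_n$, with multiplication $((c_1,\dots,c_n);\pi)\cdot((c'_1,\dots,c'_n);\pi')=((c_1+c'_{\pi^{ -1}(1)},\dots,c_n+c'_{\pi^{ -1}(n)});\pi\pi')$, $(\pi\pi')(j)=\pi(\pi'(j))$. $G(r,p,n)$ is the subgroup of elements with $\sum_i c_i\equiv0\pmod p$. Thus $t_i$ is the permutation with $t_i(1)=i+1$, $t_i(j)=j-1$ for $2\le j\le i+1$, $t_i(j)=j$ for $j>i+1$. In $\bar c_i$ the first coordinate is $1$, the last coordinate is as shown, and all other coordinates are $0$. A sequence $(a_1,\dots,a_m)$ of elements of a finite group $G$ is a perfect basis if every $g\in G$ has a unique presentation $g=a_1^{k_1}\cdots a_m^{k_m}$ with $0\le k_i<o(a_i)$,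 where $o(a_i)$ is the order of $a_i$. -}

module Defs where

open import Data.Nat using (ℕ; zero; suc; _+_; _*_; _∸_; _<_; NonZero; _<?_)
open import Data.Nat.DivMod using (_%_; m%n<n)
open import Data.Nat.Divisibility using (_∣_)
open import Data.Nat.Properties using (<⇒≤; ≤-trans; n≤1+n)
open import Data.Nat.Induction using ()
open import Data.Fin using (Fin; toℕ; fromℕ<; opposite) renaming (zero to fzero; suc to fsuc)
open import Data.Fin.Permutation using (Permutation′; _⟨$⟩ʳ_; _⟨$⟩ˡ_; _∘ₚ_; transpose) renaming (id to idₚ)
open import Data.List using (List; map; allFin)
open import Data.Nat.ListAction using (sum)
open import Data.Product using (Σ; _×_; _,_)
open import Relation.Nullary using (¬_; yes; no)
open import Relation.Binary.PropositionalEquality using (_≡_)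
open import Data.Nat using (_≟_)

module _ (r : ℕ) .{{_ : NonZero r}} where

  [_]ᵣ : ℕ → Fin r
  [ m ]ᵣ = fromℕ< (m%n<n m r)

  _+ᵣ_ : Fin r → Fin r → Fin r
  a +ᵣ b = [ toℕ a + toℕ b ]ᵣ

  _-ᵣ_ : Fin r → Fin r → Fin r
  a -ᵣ b = [ toℕ a + (r ∸ toℕ b) ]ᵣ

record Elt (r n : ℕ) : Set where
  constructor ⟪_﹔_⟫
  field
    coord : Fin n → Fin r
    perm  : Permutation′ n
open Elt public

-- composition of permutations with (π π')(j) = π (π' j)
_⊚_ : {n : ℕ} → Permutation′ n → Permutation′ n → Permutation′ n
π ⊚ π′ = π′ ∘ₚ π

module _ {r n : ℕ} .{{_ : NonZero r}} where

  _≈ᴳ_ : Elt r n → Elt r n → Set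
  g ≈ᴳ h = ((j : Fin n) → coord g j ≡ coord h j)
         × ((j : Fin n) → perm g ⟨$⟩ʳ j ≡ perm h ⟨$⟩ʳ j)

  _·_ : Elt r n → Elt r n → Elt r n
  g · h = ⟪ (λ j → _+ᵣ_ r (coord g j) (coord h (perm g ⟨$⟩ˡ j))) ﹔ perm g ⊚ perm h ⟫

  e : Elt r n
  e = ⟪ (λ _ → [_]ᵣ r 0) ﹔ idₚ ⟫

  _^ᴳ_ : Elt r n → ℕ → Elt r n
  g ^ᴳ zero  = e
  g ^ᴳ suc k = g · (g ^ᴳ k)

  IsOrder : Elt r n → ℕ → Set
  IsOrder g k = (0 < k) × ((g ^ᴳ k) ≈ᴳ e)
              × ((j : ℕ) → 0 < j → j < k → ¬ ((g ^ᴳ j) ≈ᴳ e))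

  present : {m : ℕ} → (Fin m → Elt r n) → (Fin m → ℕ) → Elt r n
  present {zero}  a k = e
  present {suc m} a k = (a fzero ^ᴳ k fzero) · present (λ i → a (fsuc i)) (λ i → k (fsuc i))

  IsPerfectBasis : (Elt r n → Set) → {m : ℕ} → (Fin m → Elt r n) → Set
  IsPerfectBasis H {m} a =
    Σ (Fin m → ℕ) λ o →
      ((i : Fin m) → IsOrder (a i) (o i))
    × ((i : Fin m) → H (a i))
    × ((g : Elt r n) → H g →
         (Σ (Fin m → ℕ) λ k → ((i : Fin m) → k i < o i) × (present a k ≈ᴳ g))
       × ((k k′ : Fin m → ℕ) → ((i : Fin m) → k i < o i) → ((i : Fin m) → k′ i < o i)
           → present a k ≈ᴳ g → present a k′ ≈ᴳ g → (i : Fin m) → k i ≡ k′ i))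

InG : (r p n : ℕ) → Elt r n → Set
InG r p n g = p ∣ sum (map (λ j → toℕ (coord g j)) (allFin n))

-- sᵢ = (i, i+1) (1-indexed), i.e. swaps 0-indexed positions i-1 and i;
-- identity if out of range (never used out of range).
s : {n : ℕ} → ℕ → Permutation′ n
s {n} zero = idₚ
s {n} (suc k) with suc k <? n
... | yes p = transpose (fromℕ< (≤-trans (n≤1+n (suc k)) p)) (fromℕ< p)
... | no _  = idₚ

t : {n : ℕ} → ℕ → Permutation′ n
t zero    = idₚ
t (suc i) = s (suc i) ⊚ t i

cbar : (r p n α : ℕ) .{{_ : NonZero r}} → Fin n → Fin n → Fin r
cbar r p n α i j with toℕ j ≟ 0
... | yes _ = [_]ᵣ r 1
... | no _ with suc (toℕ j) ≟ n
...   | no _  = [_]ᵣ r 0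
...   | yes _ with suc (toℕ i) ≟ n
...     | yes _ = _-ᵣ_ r ([_]ᵣ r p) ([_]ᵣ r 1)
...     | no _  = _-ᵣ_ r ([_]ᵣ r (α * p)) ([_]ᵣ r 1)

u : (r p n α : ℕ) .{{_ : NonZero r}} → Fin n → Elt r n
u r p n α i = ⟪ cbar r p n α i ﹔ t (toℕ i) ⟫

𝐮 : (r p n α : ℕ) .{{_ : NonZero r}} → Fin n → Elt r n
𝐮 r p n α i = u r p n α (opposite i)

module Submission where

open import Defs
open import Data.Nat
open import Data.Nat.Properties
open import Data.Nat.DivMod
open import Data.Nat.Divisibility
open import Data.Nat.GCD using (gcd; gcd-greatest; gcd[m,n]∣m; gcd[m,n]∣n; module Bézout)
open import Data.Nat.Coprimality using (Coprime; coprime?; coprime-divisor; gcd≡1⇒coprime; coprime-Bézout)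
open import Data.Nat.Primality using (Prime; euclidsLemma; prime⇒irreducible; prime⇒nonTrivial)
open import Data.Nat.Primality.Factorisation using (factorise)
open import Data.Nat.GeneralisedArithmetic using (fold; fold-+)
open import Data.Nat.ListAction using (sum; product)
open import Data.Nat.Tactic.RingSolver using (solve-∀)
open import Data.Fin using (Fin; toℕ; fromℕ<; fromℕ; inject₁; opposite) renaming (zero to fzero; suc to fsuc)
import Data.Fin.Properties as Finₚ
open import Data.Fin.Properties
  using (toℕ-fromℕ<; fromℕ<-cong; toℕ-injective; toℕ<n; toℕ-fromℕ; inject₁ℕ<; toℕ-inject₁; opposite-prop)
open import Data.Fin.Permutation as Perm using (_⟨$⟩ʳ_; _⟨$⟩ˡ_; inverseˡ; inverseʳ; transpose)
open import Data.List using ([]; _∷_; map; allFin; tabulate)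
open import Data.List.Properties using (map-tabulate; map-cong)
open import Data.List.Relation.Unary.All using (_∷_)
import Data.Vec.Functional as Vector
open import Data.Empty using (⊥; ⊥-elim)
open import Data.Product using (Σ; _×_; _,_; proj₁; proj₂)
open import Data.Sum using (inj₁; inj₂)
open import Level using (0ℓ)
open import Relation.Binary.Bundles using (Setoid)
open import Relation.Binary.PropositionalEquality
import Relation.Binary.Reasoning.Setoid as SetoidReasoning
open import Relation.Nullary using (yes; no; ¬_)
open import Relation.Nullary.Decidable using (_×-dec_)
open import Relation.Unary using (Decidable)
import Algebra.Properties.CommutativeMonoid.Sum as MonoidSum

-- G(r,n) acts faithfully on Z_r × Fin n by (c;π)·(x,j) = (x + c_{πj}, πj), so
-- identities between elements are proved by comparing actions; u_i moves the
-- positions along the cycle 0 ↦ i ↦ i−1 ↦ ⋯ ↦ 1 ↦ 0.  With L = n − 1 we use the chain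
--   G(r,p,n) ⊇ Stab L ⊇ ⋯ ⊇ Stab 0 = {e},
-- Stab J = elements fixing (0,j) for J ≤ j < L with "defect" φ = αp·c − (αp−1)·Σc
-- zero (c: the shift of the fixed last position).  Each step is a transversal:
-- every element is uniquely u^k·h, h one step down, k below the order of u.  For
-- u_I (I < L) this is read off from the orbit of (0,I), of size (I+1)r; for u_L
-- from the image of (0,L) and the defect, changed by p·X (X = n + αp(1−n)) per
-- n steps.  A generic lemma (Chain) turns such a chain into a perfect basis, and
-- α is chosen (ChooseAlpha) so that X is a unit mod r/p, using gcd(n,p,r/p) = 1.

-- Congruence modulo d, as equality of residues.  All arithmetic in Z_d is
-- carried out on natural-number representatives modulo this relation.
module Mod (d : ℕ) .{{_ : NonZero d}} where

  infix 4 _≋_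
  _≋_ : ℕ → ℕ → Set
  a ≋ b = a % d ≡ b % d

  ≋-setoid : Setoid 0ℓ 0ℓ
  ≋-setoid = record
    { Carrier = ℕ ; _≈_ = _≋_
    ; isEquivalence = record { refl = refl ; sym = sym ; trans = trans } }

  module ≋-Reasoning = SetoidReasoning ≋-setoid

  ≡⇒≋ : ∀ {a b} → a ≡ b → a ≋ b
  ≡⇒≋ = cong (_% d)

  %-≋ : ∀ a → a % d ≋ a
  %-≋ a = m%n%n≡m%n a d

  +-≋ : ∀ {a a′ b b′} → a ≋ a′ → b ≋ b′ → a + b ≋ a′ + b′
  +-≋ {a} {a′} {b} {b′} p q = begin
    (a + b) % d             ≡⟨ %-distribˡ-+ a b d ⟩
    (a % d + b % d) % d     ≡⟨ cong₂ (λ x y → (x + y) % d) p q ⟩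
    (a′ % d + b′ % d) % d   ≡⟨ %-distribˡ-+ a′ b′ d ⟨
    (a′ + b′) % d           ∎
    where open ≡-Reasoning

  *-≋ : ∀ {a a′ b b′} → a ≋ a′ → b ≋ b′ → a * b ≋ a′ * b′
  *-≋ {a} {a′} {b} {b′} p q = begin
    (a * b) % d             ≡⟨ %-distribˡ-* a b d ⟩
    (a % d * (b % d)) % d   ≡⟨ cong₂ (λ x y → (x * y) % d) p q ⟩
    (a′ % d * (b′ % d)) % d ≡⟨ %-distribˡ-* a′ b′ d ⟨
    (a′ * b′) % d           ∎
    where open ≡-Reasoning

  +-congˡ-≋ : ∀ {b b′ a} → b ≋ b′ → a + b ≋ a + b′
  +-congˡ-≋ {a = a} = +-≋ {a} refl

  *-congˡ-≋ : ∀ {b b′ a} → b ≋ b′ → a * b ≋ a * b′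
  *-congˡ-≋ {a = a} = *-≋ {a} refl

  +-multiple : ∀ a k → a + k * d ≋ a
  +-multiple a k = [m+kn]%n≡m%n a k d

  multiple≋0 : ∀ k → k * d ≋ 0
  multiple≋0 k = +-multiple 0 k

  ≋0⇒%≡0 : ∀ {a} → a ≋ 0 → a % d ≡ 0
  ≋0⇒%≡0 a≋0 = trans a≋0 (m*n%n≡0 0 d)

  neg : ℕ → ℕ
  neg c = d ∸ c % d

  +-neg : ∀ c → c + neg c ≋ 0
  +-neg c = begin
    c + neg c         ≈⟨ +-≋ (%-≋ c) refl ⟨
    c % d + neg c     ≡⟨ m+[n∸m]≡n (<⇒≤ (m%n<n c d)) ⟩
    d                 ≡⟨ *-identityˡ d ⟨
    1 * d             ≈⟨ multiple≋0 1 ⟩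
    0                 ∎
    where open ≋-Reasoning

  1+[x-1]≋x : ∀ x → suc (x + neg 1) ≋ x
  1+[x-1]≋x x = begin
    suc (x + neg 1)   ≡⟨ +-suc x (neg 1) ⟨
    x + (1 + neg 1)   ≈⟨ +-congˡ-≋ {a = x} (+-neg 1) ⟩
    x + 0             ≡⟨ +-identityʳ x ⟩
    x                 ∎
    where open ≋-Reasoning

  +-cancelʳ-≋ : ∀ {a b} c → a + c ≋ b + c → a ≋ b
  +-cancelʳ-≋ {a} {b} c p = begin
    a                 ≡⟨ +-identityʳ a ⟨
    a + 0             ≈⟨ +-congˡ-≋ {a = a} (+-neg c) ⟨
    a + (c + neg c)   ≡⟨ +-assoc a c (neg c) ⟨
    a + c + neg c     ≈⟨ +-≋ p refl ⟩
    b + c + neg c     ≡⟨ +-assoc b c (neg c) ⟩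
    b + (c + neg c)   ≈⟨ +-congˡ-≋ {a = b} (+-neg c) ⟩
    b + 0             ≡⟨ +-identityʳ b ⟩
    b                 ∎
    where open ≋-Reasoning

  residue-≡ : ∀ {a b} → a < d → b < d → a ≋ b → a ≡ b
  residue-≡ {a} {b} a<d b<d p = trans (sym (m<n⇒m%n≡m a<d)) (trans p (m<n⇒m%n≡m b<d))

module Residues (r : ℕ) .{{_ : NonZero r}} where
  open Mod r public

  ⟦_⟧ : ℕ → Fin r
  ⟦ a ⟧ = [_]ᵣ r a

  infixl 6 _⊕_
  _⊕_ : Fin r → Fin r → Fin r
  x ⊕ y = _+ᵣ_ r x y

  toℕ-⟦⟧ : ∀ a → toℕ ⟦ a ⟧ ≡ a % r
  toℕ-⟦⟧ a = toℕ-fromℕ< (m%n<n a r)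

  toℕ-⟦⟧-≋ : ∀ a → toℕ ⟦ a ⟧ ≋ a
  toℕ-⟦⟧-≋ a = trans (cong (_% r) (toℕ-⟦⟧ a)) (%-≋ a)

  ⟦⟧-cong : ∀ {a b} → a ≋ b → ⟦ a ⟧ ≡ ⟦ b ⟧
  ⟦⟧-cong {a} {b} p = fromℕ<-cong _ _ p (m%n<n a r) (m%n<n b r)

  ⟦⟧-injective : ∀ {a b} → ⟦ a ⟧ ≡ ⟦ b ⟧ → a ≋ b
  ⟦⟧-injective {a} {b} p = trans (sym (toℕ-⟦⟧ a)) (trans (cong toℕ p) (toℕ-⟦⟧ b))

  ⟦toℕ⟧ : (x : Fin r) → ⟦ toℕ x ⟧ ≡ x
  ⟦toℕ⟧ x = toℕ-injective (trans (toℕ-⟦⟧ (toℕ x)) (m<n⇒m%n≡m (toℕ<n x)))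

  ⊕-⟦⟧ : ∀ a b → ⟦ a ⟧ ⊕ ⟦ b ⟧ ≡ ⟦ a + b ⟧
  ⊕-⟦⟧ a b = ⟦⟧-cong (+-≋ (toℕ-⟦⟧-≋ a) (toℕ-⟦⟧-≋ b))

  -ᵣ-⟦⟧ : ∀ a b → _-ᵣ_ r ⟦ a ⟧ ⟦ b ⟧ ≡ ⟦ a + neg b ⟧
  -ᵣ-⟦⟧ a b = ⟦⟧-cong (+-≋ (toℕ-⟦⟧-≋ a) (≡⇒≋ (cong (r ∸_) (toℕ-⟦⟧ b))))

module _ {d D : ℕ} .{{_ : NonZero d}} .{{_ : NonZero D}} (d∣D : d ∣ D) where
  private
    module d = Mod d
    module D = Mod D

  ≋-reduce : ∀ {a b} → a D.≋ b → a d.≋ b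
  ≋-reduce {a} {b} eq = trans (sym (m∣n⇒o%n%m≡o%m d D a d∣D)) (trans (cong (_% d) eq) (m∣n⇒o%n%m≡o%m d D b d∣D))

  ∣-≋ : ∀ {a b} → a D.≋ b → d ∣ b → d ∣ a
  ∣-≋ {a} {b} eq d∣b = m%n≡0⇒n∣m a d (trans (≋-reduce eq) (n∣m⇒m%n≡0 b d d∣b))

module Scaling (m p r : ℕ) .{{_ : NonZero m}} .{{_ : NonZero p}} .{{_ : NonZero r}} (r≡mp : r ≡ m * p) where
  private
    module R = Mod r
    module M = Mod m
    instance
      mp≢0 : NonZero (m * p)
      mp≢0 = m*n≢0 m p

    mod-r : ∀ a → a % r ≡ a % (m * p)
    mod-r a = %-congʳ r≡mp

    mod-scaled : ∀ a → (a * p) % r ≡ a % m * p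
    mod-scaled a = trans (mod-r (a * p)) (sym (m%n*o≡m*o%[n*o] a m p))

  scale : ∀ {a b} → a M.≋ b → a * p R.≋ b * p
  scale {a} {b} eq = trans (mod-scaled a) (trans (cong (_* p) eq) (sym (mod-scaled b)))

  unscale : ∀ {a b} → a * p R.≋ b * p → a M.≋ b
  unscale {a} {b} eq = *-cancelʳ-≡ (a % m) (b % m) p (trans (sym (mod-scaled a)) (trans eq (mod-scaled b)))

  reduce : ∀ {a b} → a R.≋ b → a M.≋ b
  reduce = ≋-reduce (divides p (trans r≡mp (*-comm m p)))

infixr 9 _^[_]_
_^[_]_ : {A : Set} → (A → A) → ℕ → A → A
f ^[ k ] x = fold x f k

^[]-injective : {A : Set} (f : A → A) → (∀ {x y} → f x ≡ f y → x ≡ y)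
              → ∀ k {x y} → f ^[ k ] x ≡ f ^[ k ] y → x ≡ y
^[]-injective f inj zero    eq = eq
^[]-injective f inj (suc k) eq = ^[]-injective f inj k (inj eq)

module _ {A : Set} (f : A → A) where

  ^[]-+ : ∀ j k x → f ^[ j + k ] x ≡ f ^[ j ] (f ^[ k ] x)
  ^[]-+ j k x = fold-+ x f j

  ^[]-* : ∀ k N x → f ^[ k * N ] x ≡ (f ^[ N ]_) ^[ k ] x
  ^[]-* zero    N x = refl
  ^[]-* (suc k) N x = trans (^[]-+ N (k * N) x) (cong (f ^[ N ]_) (^[]-* k N x))

  return-after : (∀ {x y} → f x ≡ f y → x ≡ y) → ∀ {a b z} → a ≤ b
               → f ^[ a ] z ≡ f ^[ b ] z → f ^[ b ∸ a ] z ≡ z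
  return-after inj {a} {b} {z} a≤b eq = ^[]-injective f inj a (begin
    f ^[ a ] (f ^[ b ∸ a ] z)  ≡⟨ ^[]-+ a (b ∸ a) z ⟨
    f ^[ a + (b ∸ a) ] z       ≡⟨ cong (λ w → f ^[ w ] z) (m+[n∸m]≡n a≤b) ⟩
    f ^[ b ] z                 ≡⟨ eq ⟨
    f ^[ a ] z                 ∎)
    where open ≡-Reasoning

  orbit-injective : (∀ {x y} → f x ≡ f y → x ≡ y) → ∀ {M z}
    → (∀ d → d < M → f ^[ d ] z ≡ z → d ≡ 0)
    → ∀ {k k′} → k < M → k′ < M → f ^[ k ] z ≡ f ^[ k′ ] z → k ≡ k′
  orbit-injective inj {M} {z} first-return {k} {k′} k<M k′<M eq with ≤-total k k′
  ... | inj₁ k≤k′ = ≤-antisym k≤k′ (m∸n≡0⇒m≤n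
          (first-return (k′ ∸ k) (≤-<-trans (m∸n≤m k′ k) k′<M) (return-after inj k≤k′ eq)))
  ... | inj₂ k′≤k = ≤-antisym (m∸n≡0⇒m≤n
          (first-return (k ∸ k′) (≤-<-trans (m∸n≤m k k′) k<M) (return-after inj k′≤k (sym eq)))) k′≤k

  orbit-reverse : ∀ M .{{_ : NonZero M}} → (∀ x → f ^[ M ] x ≡ x)
    → ∀ {j x y} → f ^[ j ] x ≡ y → Σ ℕ λ k → k < M × f ^[ k ] y ≡ x
  orbit-reverse M period {j} {x} {y} eq = k , m%n<n _ M , back
    where
    open Mod M using (_≋_; +-≋; %-≋; multiple≋0; ≋0⇒%≡0)
    -- k ≡ −j (mod M)
    k : ℕ
    k = (M ∸ 1) * j % M
    k+j≋0 : k + j ≋ 0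
    k+j≋0 = begin
      (M ∸ 1) * j % M + j   ≈⟨ +-≋ (%-≋ ((M ∸ 1) * j)) refl ⟩
      (M ∸ 1) * j + j       ≡⟨ +-comm ((M ∸ 1) * j) j ⟩
      suc (M ∸ 1) * j       ≡⟨ cong (_* j) (m+[n∸m]≡n (>-nonZero⁻¹ M)) ⟩
      M * j                 ≡⟨ *-comm M j ⟩
      j * M                 ≈⟨ multiple≋0 j ⟩
      0                     ∎
      where open Mod.≋-Reasoning M
    full-turns : ∀ t → f ^[ t * M ] x ≡ x
    full-turns zero    = refl
    full-turns (suc t) = trans (^[]-+ M (t * M) x) (trans (cong (f ^[ M ]_) (full-turns t)) (period x))
    back : f ^[ k ] y ≡ x
    back = begin
      f ^[ k ] y                                ≡⟨ cong (f ^[ k ]_) eq ⟨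
      f ^[ k ] (f ^[ j ] x)                     ≡⟨ ^[]-+ k j x ⟨
      f ^[ k + j ] x                            ≡⟨ cong (λ w → f ^[ w ] x) (m≡m%n+[m/n]*n (k + j) M) ⟩
      f ^[ (k + j) % M + (k + j) / M * M ] x    ≡⟨ cong (λ w → f ^[ w + (k + j) / M * M ] x) (≋0⇒%≡0 k+j≋0) ⟩
      f ^[ (k + j) / M * M ] x                  ≡⟨ full-turns ((k + j) / M) ⟩
      x                                         ∎
      where open ≡-Reasoning

-- It is faithful, so
-- every identity in G(r,n) is established by comparing actions.
module Action (r n : ℕ) .{{_ : NonZero r}} where
  open Residues r public

  Pt : Set
  Pt = Fin r × Fin n

  act : Elt r n → Pt → Pt
  act g (x , j) = (x ⊕ coord g (perm g ⟨$⟩ʳ j) , perm g ⟨$⟩ʳ j)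

  ⊕-rotate : ∀ x y z → x ⊕ (y ⊕ z) ≡ (x ⊕ z) ⊕ y
  ⊕-rotate x y z = ⟦⟧-cong (begin
    toℕ x + toℕ (y ⊕ z)                 ≈⟨ +-congˡ-≋ {a = toℕ x} (toℕ-⟦⟧-≋ (toℕ y + toℕ z)) ⟩
    toℕ x + (toℕ y + toℕ z)             ≡⟨ cong (toℕ x +_) (+-comm (toℕ y) (toℕ z)) ⟩
    toℕ x + (toℕ z + toℕ y)             ≡⟨ +-assoc (toℕ x) (toℕ z) (toℕ y) ⟨
    toℕ x + toℕ z + toℕ y               ≈⟨ +-≋ (toℕ-⟦⟧-≋ (toℕ x + toℕ z)) refl ⟨
    toℕ (x ⊕ z) + toℕ y                 ∎)
    where open ≋-Reasoning

  ⊕-identityʳ : ∀ x → x ⊕ ⟦ 0 ⟧ ≡ x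
  ⊕-identityʳ x = trans (⟦⟧-cong (trans (+-congˡ-≋ {a = toℕ x} (toℕ-⟦⟧-≋ 0)) (≡⇒≋ (+-identityʳ _)))) (⟦toℕ⟧ x)

  ⊕-identityˡ : ∀ x → ⟦ 0 ⟧ ⊕ x ≡ x
  ⊕-identityˡ x = trans (cong ⟦_⟧ (+-comm (toℕ ⟦ 0 ⟧) (toℕ x))) (⊕-identityʳ x)

  act-· : ∀ g h pt → act (g · h) pt ≡ act g (act h pt)
  act-· g h (x , j) = cong (_, _) (trans
    (cong (λ k → x ⊕ (coord g (perm g ⟨$⟩ʳ (perm h ⟨$⟩ʳ j)) ⊕ coord h k)) (inverseˡ (perm g)))
    (⊕-rotate x _ _))

  act-e : ∀ pt → act e pt ≡ pt
  act-e (x , j) = cong (_, j) (⊕-identityʳ x)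

  act-^ : ∀ g k pt → act (g ^ᴳ k) pt ≡ act g ^[ k ] pt
  act-^ g zero    pt = act-e pt
  act-^ g (suc k) pt = trans (act-· g (g ^ᴳ k) pt) (cong (act g) (act-^ g k pt))

  act-^· : ∀ g k h pt → act ((g ^ᴳ k) · h) pt ≡ act g ^[ k ] act h pt
  act-^· g k h pt = trans (act-· (g ^ᴳ k) h pt) (act-^ g k (act h pt))

  act-≈ : ∀ {g h} → g ≈ᴳ h → ∀ pt → act g pt ≡ act h pt
  act-≈ {g} {h} (c≡ , π≡) (x , j) =
    cong₂ (λ y k → (x ⊕ y , k)) (trans (c≡ _) (cong (coord h) (π≡ j))) (π≡ j)

  act⇒≈ : ∀ {g h} → (∀ j → act g (⟦ 0 ⟧ , j) ≡ act h (⟦ 0 ⟧ , j)) → g ≈ᴳ h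
  act⇒≈ {g} {h} agree = coord≡ , π≡
    where
    π≡ : ∀ j → perm g ⟨$⟩ʳ j ≡ perm h ⟨$⟩ʳ j
    π≡ j = cong proj₂ (agree j)
    coord≡ : ∀ j → coord g j ≡ coord h j
    coord≡ j = begin
      coord g j                        ≡⟨ cong (coord g) (inverseʳ (perm g)) ⟨
      coord g (perm g ⟨$⟩ʳ i)          ≡⟨ ⊕-identityˡ _ ⟨
      ⟦ 0 ⟧ ⊕ coord g (perm g ⟨$⟩ʳ i)  ≡⟨ cong proj₁ (agree i) ⟩
      ⟦ 0 ⟧ ⊕ coord h (perm h ⟨$⟩ʳ i)  ≡⟨ ⊕-identityˡ _ ⟩
      coord h (perm h ⟨$⟩ʳ i)          ≡⟨ cong (coord h) (π≡ i) ⟨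
      coord h (perm g ⟨$⟩ʳ i)          ≡⟨ cong (coord h) (inverseʳ (perm g)) ⟩
      coord h j                        ∎
      where
      open ≡-Reasoning
      i : Fin n
      i = perm g ⟨$⟩ˡ j

  ⊕-cancelʳ : ∀ x y z → x ⊕ z ≡ y ⊕ z → x ≡ y
  ⊕-cancelʳ x y z eq = toℕ-injective
    (residue-≡ (toℕ<n x) (toℕ<n y) (+-cancelʳ-≋ (toℕ z) (⟦⟧-injective eq)))

  perm-injective : ∀ (π : Perm.Permutation′ n) {j k} → π ⟨$⟩ʳ j ≡ π ⟨$⟩ʳ k → j ≡ k
  perm-injective π {j} {k} eq = trans (sym (inverseˡ π)) (trans (cong (π ⟨$⟩ˡ_) eq) (inverseˡ π))

  act-injective : ∀ g {pt pt′} → act g pt ≡ act g pt′ → pt ≡ pt′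
  act-injective g {x , j} {y , k} eq = cong₂ _,_
    (⊕-cancelʳ x y _ (trans (cong proj₁ eq) (cong (λ i → y ⊕ coord g (perm g ⟨$⟩ʳ i)) (sym j≡k))))
    j≡k
    where
    j≡k : j ≡ k
    j≡k = perm-injective (perm g) (cong proj₂ eq)

  ≈-sym : ∀ {g h : Elt r n} → g ≈ᴳ h → h ≈ᴳ g
  ≈-sym (c≡ , π≡) = (λ j → sym (c≡ j)) , (λ j → sym (π≡ j))

  ≈-trans : ∀ {g h k : Elt r n} → g ≈ᴳ h → h ≈ᴳ k → g ≈ᴳ k
  ≈-trans (c≡ , π≡) (c≡′ , π≡′) = (λ j → trans (c≡ j) (c≡′ j)) , (λ j → trans (π≡ j) (π≡′ j))

  ^·-congʳ : ∀ (g : Elt r n) k {h h′} → h ≈ᴳ h′ → ((g ^ᴳ k) · h) ≈ᴳ ((g ^ᴳ k) · h′)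
  ^·-congʳ g k {h} {h′} h≈h′ = act⇒≈ {(g ^ᴳ k) · h} {(g ^ᴳ k) · h′} λ j →
    trans (act-^· g k h _) (trans (cong (act g ^[ k ]_) (act-≈ {h} {h′} h≈h′ _)) (sym (act-^· g k h′ _)))

  ^·-cancelˡ : ∀ (g : Elt r n) k {h h′} → ((g ^ᴳ k) · h) ≈ᴳ ((g ^ᴳ k) · h′) → h ≈ᴳ h′
  ^·-cancelˡ g k {h} {h′} eq = act⇒≈ {h} {h′} λ j → ^[]-injective (act g) (act-injective g) k
    (trans (sym (act-^· g k h _)) (trans (act-≈ {(g ^ᴳ k) · h} {(g ^ᴳ k) · h′} eq _) (act-^· g k h′ _)))

  act-translate : ∀ g j j′ x c → act g (⟦ 0 ⟧ , j) ≡ (⟦ c ⟧ , j′) → act g (⟦ x ⟧ , j) ≡ (⟦ x + c ⟧ , j′)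
  act-translate g j j′ x c eq = cong₂ _,_
    (trans (cong (⟦ x ⟧ ⊕_) (trans (sym (⊕-identityˡ _)) (cong proj₁ eq))) (⊕-⟦⟧ x c))
    (cong proj₂ eq)

  At : Pt → ℕ → ℕ → Set
  At pt q c = (proj₁ pt ≡ ⟦ c ⟧) × (toℕ (proj₂ pt) ≡ q)

  At-self : ∀ x j → At (x , j) (toℕ j) (toℕ x)
  At-self x j = sym (⟦toℕ⟧ x) , refl

  At-≋ : ∀ {pt q c c′} → c ≋ c′ → At pt q c → At pt q c′
  At-≋ c≋c′ (x≡ , j≡) = trans x≡ (⟦⟧-cong c≋c′) , j≡

  At-pos : ∀ {pt q q′ c} → q ≡ q′ → At pt q c → At pt q′ c
  At-pos refl at = at

  At-unique : ∀ {pt pt′ q c c′} → At pt q c → At pt′ q c′ → c ≋ c′ → pt ≡ pt′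
  At-unique (x≡ , j≡) (x≡′ , j≡′) c≋c′ =
    cong₂ _,_ (trans x≡ (trans (⟦⟧-cong c≋c′) (sym x≡′))) (toℕ-injective (trans j≡ (sym j≡′)))

  At-functional : ∀ {pt q q′ c c′} → At pt q c → At pt q′ c′ → q ≡ q′ × c ≋ c′
  At-functional (x≡ , j≡) (x≡′ , j≡′) = trans (sym j≡) j≡′ , ⟦⟧-injective (trans (sym x≡) x≡′)

  act-At : ∀ g {pt q c} q′ v → At pt q c → toℕ (perm g ⟨$⟩ʳ proj₂ pt) ≡ q′
         → coord g (perm g ⟨$⟩ʳ proj₂ pt) ≡ ⟦ v ⟧ → At (act g pt) q′ (c + v)
  act-At g {x , j} {c = c} q′ v (x≡ , _) π≡ coord≡ = trans (cong₂ _⊕_ x≡ coord≡) (⊕-⟦⟧ c v) , π≡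

  iterate-At : ∀ (F : Pt → Pt) {q} v → (∀ {pt a} → At pt q a → At (F pt) q (a + v))
             → ∀ k {pt a} → At pt q a → At (F ^[ k ] pt) q (a + k * v)
  iterate-At F v step zero    {a = a} at = At-≋ (≡⇒≋ (sym (+-identityʳ a))) at
  iterate-At F v step (suc k) {a = a} at = At-≋ (≡⇒≋ (reassoc a (k * v) v)) (step (iterate-At F v step k at))
    where
    reassoc : ∀ x y z → x + y + z ≡ x + (z + y)
    reassoc x y z = trans (+-assoc x y z) (cong (x +_) (+-comm y z))

module Chain (r n : ℕ) .{{_ : NonZero r}} where
  open Action r n

  Bounded : {M : ℕ} → (Fin M → ℕ) → (Fin M → ℕ) → Set
  Bounded o k = ∀ i → k i < o i

  record IsChain {M : ℕ} (a : Fin M → Elt r n) (o : Fin M → ℕ) (Level : ℕ → Elt r n → Set) : Set where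
    field
      bottom-e  : Level M e
      bottom    : ∀ {g} → Level M g → g ≈ᴳ e
      closed    : ∀ i k {h} → Level (suc (toℕ i)) h → Level (toℕ i) ((a i ^ᴳ k) · h)
      decompose : ∀ i {g} → Level (toℕ i) g →
                  Σ ℕ λ k → k < o i × Σ (Elt r n) λ h → Level (suc (toℕ i)) h × ((a i ^ᴳ k) · h) ≈ᴳ g
      exponent-unique : ∀ i {k k′ h h′} → k < o i → k′ < o i
                  → Level (suc (toℕ i)) h → Level (suc (toℕ i)) h′
                  → ((a i ^ᴳ k) · h) ≈ᴳ ((a i ^ᴳ k′) · h′) → k ≡ k′

  module _ {M : ℕ} {a : Fin (suc M) → Elt r n} {o : Fin (suc M) → ℕ} {Level : ℕ → Elt r n → Set} where

    tail : IsChain a o Level → IsChain (λ i → a (fsuc i)) (λ i → o (fsuc i)) (λ i → Level (suc i))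
    tail C = record
      { bottom-e = bottom-e ; bottom = bottom
      ; closed = λ i → closed (fsuc i)
      ; decompose = λ i → decompose (fsuc i)
      ; exponent-unique = λ i → exponent-unique (fsuc i) }
      where open IsChain C

  present-level : ∀ {M} {a : Fin M → Elt r n} {o Level} → IsChain a o Level → ∀ k → Level 0 (present a k)
  present-level {zero}  C k = IsChain.bottom-e C
  present-level {suc M} C k = IsChain.closed C fzero (k fzero) (present-level (tail C) (λ i → k (fsuc i)))

  presentation-exists : ∀ {M} {a : Fin M → Elt r n} {o Level} → IsChain a o Level
    → ∀ {g} → Level 0 g → Σ (Fin M → ℕ) λ k → Bounded o k × present a k ≈ᴳ g
  presentation-exists {zero} C {g} g∈ = (λ ()) , (λ ()) , ≈-sym {g} {e} (IsChain.bottom C g∈)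
  presentation-exists {suc M} {a} C {g} g∈
    with k₀ , k₀< , h , h∈ , a^k₀h≈g ← IsChain.decompose C fzero g∈
    with k , k< , ak≈h ← presentation-exists (tail C) h∈
    = (k₀ Vector.∷ k) , bounded , ≈-trans {present a (k₀ Vector.∷ k)} {(a fzero ^ᴳ k₀) · h} {g}
        (^·-congʳ (a fzero) k₀ {present (λ i → a (fsuc i)) k} {h} ak≈h) a^k₀h≈g
    where
    bounded : Bounded _ (k₀ Vector.∷ k)
    bounded fzero    = k₀<
    bounded (fsuc i) = k< i

  presentation-unique : ∀ {M} {a : Fin M → Elt r n} {o Level} → IsChain a o Level
    → ∀ {k k′} → Bounded o k → Bounded o k′ → present a k ≈ᴳ present a k′ → ∀ i → k i ≡ k′ i
  presentation-unique {suc M} {a} C {k} {k′} k< k′< eq = same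
    where
    rest rest′ : Elt r n
    rest  = present (λ i → a (fsuc i)) (λ i → k (fsuc i))
    rest′ = present (λ i → a (fsuc i)) (λ i → k′ (fsuc i))
    head≡ : k fzero ≡ k′ fzero
    head≡ = IsChain.exponent-unique C fzero (k< fzero) (k′< fzero)
      (present-level (tail C) _) (present-level (tail C) _) eq
    rest≈ : rest ≈ᴳ rest′
    rest≈ = ^·-cancelˡ (a fzero) (k fzero) {rest} {rest′}
      (subst (λ j → ((a fzero ^ᴳ k fzero) · rest) ≈ᴳ ((a fzero ^ᴳ j) · rest′)) (sym head≡) eq)
    same : ∀ i → k i ≡ k′ i
    same fzero    = head≡
    same (fsuc i) = presentation-unique (tail C) (λ i → k< (fsuc i)) (λ i → k′< (fsuc i)) rest≈ i

open MonoidSum +-0-commutativeMonoid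
  using (sum-permute; ∑-distrib-+; sum-init-last; sum-replicate-zero)
  renaming (sum to ∑)

sum-map-allFin : ∀ {m} (f : Fin m → ℕ) → sum (map f (allFin m)) ≡ ∑ f
sum-map-allFin {m} f = trans (cong sum (map-tabulate (λ i → i) f)) (sum-tabulate f)
  where
  sum-tabulate : ∀ {k} (f : Fin k → ℕ) → sum (tabulate f) ≡ ∑ f
  sum-tabulate {zero}  f = refl
  sum-tabulate {suc k} f = cong (f fzero +_) (sum-tabulate (λ i → f (fsuc i)))

module CoordinateSum (r n : ℕ) .{{_ : NonZero r}} where
  open Action r n

  csum : Elt r n → ℕ
  csum g = sum (map (λ j → toℕ (coord g j)) (allFin n))

  csum-≈ : ∀ {g h} → g ≈ᴳ h → csum g ≡ csum h
  csum-≈ (coord≡ , _) = cong sum (map-cong (λ j → cong toℕ (coord≡ j)) (allFin n))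

  ∑-≋ : ∀ {m} (f f′ : Fin m → ℕ) → (∀ i → f i ≋ f′ i) → ∑ f ≋ ∑ f′
  ∑-≋ {zero}  f f′ eq = refl
  ∑-≋ {suc m} f f′ eq = +-≋ (eq fzero) (∑-≋ (λ i → f (fsuc i)) (λ i → f′ (fsuc i)) (λ i → eq (fsuc i)))

  -- summing the coordinates of g·h visits the coordinates of h in the order π_g⁻¹
  csum-· : ∀ g h → csum (g · h) ≋ csum g + csum h
  csum-· g h = begin
    csum (g · h)                         ≡⟨ sum-map-allFin (λ j → toℕ (coord (g · h) j)) ⟩
    ∑ (λ j → toℕ (coord (g · h) j))      ≈⟨ ∑-≋ _ (λ j → cg j + ch′ j) (λ j → toℕ-⟦⟧-≋ (cg j + ch′ j)) ⟩
    ∑ (λ j → cg j + ch′ j)               ≡⟨ ∑-distrib-+ cg ch′ ⟩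
    ∑ cg + ∑ ch′                         ≡⟨ cong (∑ cg +_) (sum-permute ch (Perm.flip (perm g))) ⟨
    ∑ cg + ∑ ch                          ≡⟨ cong₂ _+_ (sum-map-allFin cg) (sum-map-allFin ch) ⟨
    csum g + csum h                      ∎
    where
    open ≋-Reasoning
    cg ch ch′ : Fin n → ℕ
    cg  = λ j → toℕ (coord g j)
    ch  = λ j → toℕ (coord h j)
    ch′ = λ j → toℕ (coord h (perm g ⟨$⟩ˡ j))

  csum-e : csum e ≋ 0
  csum-e = begin
    csum e                          ≡⟨ sum-map-allFin (λ j → toℕ (coord {r} {n} e j)) ⟩
    ∑ {n} (λ _ → toℕ ⟦ 0 ⟧)         ≈⟨ ∑-≋ {n} (λ _ → toℕ ⟦ 0 ⟧) (λ _ → 0) (λ _ → toℕ-⟦⟧-≋ 0) ⟩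
    ∑ {n} (λ _ → 0)                 ≡⟨ sum-replicate-zero n ⟩
    0                               ∎
    where open ≋-Reasoning

  csum-^ : ∀ g k → csum (g ^ᴳ k) ≋ k * csum g
  csum-^ g zero    = csum-e
  csum-^ g (suc k) = trans (csum-· g (g ^ᴳ k)) (+-congˡ-≋ {a = csum g} (csum-^ g k))

module CoordinateSumEnds (r ℓ : ℕ) .{{_ : NonZero r}} where
  open Action r (suc (suc ℓ))
  open CoordinateSum r (suc (suc ℓ))

  csum-ends : ∀ g → (∀ j → 0 < toℕ j → toℕ j < suc ℓ → coord g j ≡ ⟦ 0 ⟧)
            → csum g ≋ toℕ (coord g fzero) + toℕ (coord g (fromℕ (suc ℓ)))
  csum-ends g vanish = begin
    csum g                                        ≡⟨ sum-map-allFin c ⟩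
    c fzero + ∑ (λ i → c (fsuc i))                ≡⟨ cong (c fzero +_) (sum-init-last (λ i → c (fsuc i))) ⟩
    c fzero + (∑ middle + c last)                 ≈⟨ +-congˡ-≋ {a = c fzero} (+-≋ (∑-≋ middle (λ _ → 0) middle≋0) refl) ⟩
    c fzero + (∑ {ℓ} (λ _ → 0) + c last)          ≡⟨ cong (λ z → c fzero + (z + c last)) (sum-replicate-zero ℓ) ⟩
    c fzero + c last                              ∎
    where
    open ≋-Reasoning
    c : Fin (suc (suc ℓ)) → ℕ
    c j = toℕ (coord g j)
    last : Fin (suc (suc ℓ))
    last = fromℕ (suc ℓ)
    middle : Fin ℓ → ℕ
    middle i = c (fsuc (inject₁ i))
    middle≋0 : ∀ i → middle i ≋ 0
    middle≋0 i = trans (cong (λ x → toℕ x % r) (vanish _ (s≤s z≤n) (s≤s (inject₁ℕ< i)))) (toℕ-⟦⟧-≋ 0)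

module _ {n : ℕ} (i j : Fin n) where

  transpose-left : transpose i j ⟨$⟩ʳ i ≡ j
  transpose-left with i Finₚ.≟ i
  ... | yes _  = refl
  ... | no i≢i = ⊥-elim (i≢i refl)

  transpose-right : transpose i j ⟨$⟩ʳ j ≡ i
  transpose-right with j Finₚ.≟ i
  ... | yes j≡i = j≡i
  ... | no _ with j Finₚ.≟ j
  ...   | yes _  = refl
  ...   | no j≢j = ⊥-elim (j≢j refl)

  transpose-other : ∀ k → k ≢ i → k ≢ j → transpose i j ⟨$⟩ʳ k ≡ k
  transpose-other k k≢i k≢j with k Finₚ.≟ i
  ... | yes k≡i = ⊥-elim (k≢i k≡i)
  ... | no _ with k Finₚ.≟ j
  ...   | yes k≡j = ⊥-elim (k≢j k≡j)
  ...   | no _    = refl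

module _ {n : ℕ} (x : ℕ) (x+1<n : suc x < n) where

  private
    lower upper : Fin n
    lower = fromℕ< (<-trans (n<1+n x) x+1<n)
    upper = fromℕ< x+1<n

    s≡transpose : ∀ k → s {n} (suc x) ⟨$⟩ʳ k ≡ transpose lower upper ⟨$⟩ʳ k
    s≡transpose k with suc x <? n
    ... | yes x+1<n′ = cong (λ w → transpose lower (fromℕ< w) ⟨$⟩ʳ k) (≤-irrelevant x+1<n′ x+1<n)
    ... | no x+1≮n   = ⊥-elim (x+1≮n x+1<n)

    at-lower : ∀ (k : Fin n) → toℕ k ≡ x → k ≡ lower
    at-lower k k≡x = toℕ-injective (trans k≡x (sym (toℕ-fromℕ< _)))

    at-upper : ∀ (k : Fin n) → toℕ k ≡ suc x → k ≡ upper
    at-upper k k≡x+1 = toℕ-injective (trans k≡x+1 (sym (toℕ-fromℕ< _)))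

  s-up : ∀ (k : Fin n) → toℕ k ≡ x → toℕ (s (suc x) ⟨$⟩ʳ k) ≡ suc x
  s-up k k≡x rewrite s≡transpose k | at-lower k k≡x | transpose-left lower upper = toℕ-fromℕ< _

  s-down : ∀ (k : Fin n) → toℕ k ≡ suc x → toℕ (s (suc x) ⟨$⟩ʳ k) ≡ x
  s-down k k≡x+1 rewrite s≡transpose k | at-upper k k≡x+1 | transpose-right lower upper = toℕ-fromℕ< _

  s-fix : ∀ (k : Fin n) → toℕ k ≢ x → toℕ k ≢ suc x → toℕ (s (suc x) ⟨$⟩ʳ k) ≡ toℕ k
  s-fix k k≢x k≢x+1 rewrite s≡transpose k =
    cong toℕ (transpose-other lower upper k
      (λ k≡ → k≢x (trans (cong toℕ k≡) (toℕ-fromℕ< _)))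
      (λ k≡ → k≢x+1 (trans (cong toℕ k≡) (toℕ-fromℕ< _))))

t-zero : ∀ {n} i (j : Fin n) → i < n → toℕ j ≡ 0 → toℕ (t {n} i ⟨$⟩ʳ j) ≡ i
t-zero zero    j i<n j≡0 = j≡0
t-zero (suc i) j i<n j≡0 = s-up i i<n _ (t-zero i j (<⇒≤ i<n) j≡0)

t-above : ∀ {n} i (j : Fin n) → i < n → i < toℕ j → toℕ (t {n} i ⟨$⟩ʳ j) ≡ toℕ j
t-above zero    j i<n i<j = refl
t-above (suc i) j i<n i<j = trans
  (s-fix i i<n _ (λ eq → <⇒≢ (<-trans (n<1+n i) i<j) (sym (trans (sym tj) eq)))
                 (λ eq → <⇒≢ i<j (sym (trans (sym tj) eq))))
  tj
  where
  tj : toℕ (t i ⟨$⟩ʳ j) ≡ toℕ j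
  tj = t-above i j (<⇒≤ i<n) (<-trans (n<1+n i) i<j)

t-down : ∀ {n} i (j : Fin n) x → i < n → toℕ j ≡ suc x → x < i → toℕ (t {n} i ⟨$⟩ʳ j) ≡ x
t-down (suc i) j x i<n j≡x+1 x<i+1 with x <? i
... | yes x<i = trans
      (s-fix i i<n _ (λ eq → <⇒≢ x<i (trans (sym tj) eq))
                     (λ eq → <⇒≢ (m<n⇒m<1+n x<i) (trans (sym tj) eq)))
      tj
  where
  tj : toℕ (t i ⟨$⟩ʳ j) ≡ x
  tj = t-down i j x (<⇒≤ i<n) j≡x+1 x<i
... | no x≮i = trans (s-down i i<n _ (trans (t-above i j (<⇒≤ i<n) i<j) (trans j≡x+1 (cong suc x≡i)))) (sym x≡i)
  where
  x≡i : x ≡ i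
  x≡i = ≤-antisym (s≤s⁻¹ x<i+1) (≮⇒≥ x≮i)
  i<j : i < toℕ j
  i<j = subst (i <_) (sym j≡x+1) (s≤s (≮⇒≥ x≮i))

module Generators (r p α ℓ : ℕ) .{{_ : NonZero r}} where

  L n : ℕ
  L = suc ℓ
  n = suc L

  open Action r n public
  open CoordinateSum r n public
  open CoordinateSumEnds r ℓ public

  last : Fin n
  last = fromℕ L

  κ-low κ-top : ℕ
  κ-low = α * p + neg 1
  κ-top = p + neg 1

  U : Fin n → Elt r n
  U = u r p n α

  F : Fin n → Pt → Pt
  F i = act (U i)

  ≤L : ∀ (i : Fin n) → toℕ i ≤ L
  ≤L i = s≤s⁻¹ (toℕ<n i)

  cbar-first : ∀ i j → toℕ j ≡ 0 → cbar r p n α i j ≡ ⟦ 1 ⟧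
  cbar-first i j j≡0 with toℕ j ≟ 0
  ... | yes _  = refl
  ... | no j≢0 = ⊥-elim (j≢0 j≡0)

  cbar-middle : ∀ i j → 0 < toℕ j → toℕ j < L → cbar r p n α i j ≡ ⟦ 0 ⟧
  cbar-middle i j 0<j j<L with toℕ j ≟ 0
  ... | yes j≡0 = ⊥-elim (<⇒≢ 0<j (sym j≡0))
  ... | no _ with suc (toℕ j) ≟ n
  ...   | yes j+1≡n = ⊥-elim (<⇒≢ j<L (suc-injective j+1≡n))
  ...   | no _      = refl

  cbar-last-low : ∀ i j → toℕ j ≡ L → toℕ i < L → cbar r p n α i j ≡ ⟦ κ-low ⟧
  cbar-last-low i j j≡L i<L with toℕ j ≟ 0
  ... | yes j≡0 = ⊥-elim (0≢1+n (trans (sym j≡0) j≡L))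
  ... | no _ with suc (toℕ j) ≟ n
  ...   | no j+1≢n = ⊥-elim (j+1≢n (cong suc j≡L))
  ...   | yes _ with suc (toℕ i) ≟ n
  ...     | yes i+1≡n = ⊥-elim (<⇒≢ i<L (suc-injective i+1≡n))
  ...     | no _      = -ᵣ-⟦⟧ (α * p) 1

  cbar-last-top : ∀ i j → toℕ j ≡ L → toℕ i ≡ L → cbar r p n α i j ≡ ⟦ κ-top ⟧
  cbar-last-top i j j≡L i≡L with toℕ j ≟ 0
  ... | yes j≡0 = ⊥-elim (0≢1+n (trans (sym j≡0) j≡L))
  ... | no _ with suc (toℕ j) ≟ n
  ...   | no j+1≢n = ⊥-elim (j+1≢n (cong suc j≡L))
  ...   | yes _ with suc (toℕ i) ≟ n
  ...     | no i+1≢n = ⊥-elim (i+1≢n (cong suc i≡L))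
  ...     | yes _    = -ᵣ-⟦⟧ p 1

  module _ (i : Fin n) {pt : Pt} {a : ℕ} where

    step-down : ∀ q → suc (suc q) ≤ toℕ i → At pt (suc (suc q)) a → At (F i pt) (suc q) a
    step-down q q+2≤i at = At-≋ (≡⇒≋ (+-identityʳ a)) (act-At (U i) (suc q) 0 at lands
      (cbar-middle i _ (subst (0 <_) (sym lands) z<s)
                       (subst (_< L) (sym lands) (<-≤-trans q+2≤i (≤L i)))))
      where
      lands : toℕ (t (toℕ i) ⟨$⟩ʳ proj₂ pt) ≡ suc q
      lands = t-down (toℕ i) (proj₂ pt) (suc q) (toℕ<n i) (proj₂ at) q+2≤i

    step-land : 1 ≤ toℕ i → At pt 1 a → At (F i pt) 0 (a + 1)
    step-land 1≤i at = act-At (U i) 0 1 at lands (cbar-first i _ lands)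
      where
      lands : toℕ (t (toℕ i) ⟨$⟩ʳ proj₂ pt) ≡ 0
      lands = t-down (toℕ i) (proj₂ pt) 0 (toℕ<n i) (proj₂ at) 1≤i

    private
      wraps : At pt 0 a → toℕ (t (toℕ i) ⟨$⟩ʳ proj₂ pt) ≡ toℕ i
      wraps at = t-zero (toℕ i) (proj₂ pt) (toℕ<n i) (proj₂ at)

    step-wrap-zero : toℕ i ≡ 0 → At pt 0 a → At (F i pt) 0 (a + 1)
    step-wrap-zero i≡0 at = act-At (U i) 0 1 at (trans (wraps at) i≡0) (cbar-first i _ (trans (wraps at) i≡0))

    step-wrap-middle : 0 < toℕ i → toℕ i < L → At pt 0 a → At (F i pt) (toℕ i) a
    step-wrap-middle 0<i i<L at = At-≋ (≡⇒≋ (+-identityʳ a)) (act-At (U i) (toℕ i) 0 at (wraps at)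
      (cbar-middle i _ (subst (0 <_) (sym (wraps at)) 0<i) (subst (_< L) (sym (wraps at)) i<L)))

    step-wrap-top : toℕ i ≡ L → At pt 0 a → At (F i pt) (toℕ i) (a + κ-top)
    step-wrap-top i≡L at = act-At (U i) (toℕ i) κ-top at (wraps at) (cbar-last-top i _ (trans (wraps at) i≡L) i≡L)

    step-fixed : ∀ q → toℕ i < q → q < L → At pt q a → At (F i pt) q a
    step-fixed q i<q q<L at = At-≋ (≡⇒≋ (+-identityʳ a)) (act-At (U i) q 0 at stays
      (cbar-middle i _ (subst (0 <_) (sym stays) (≤-<-trans z≤n i<q)) (subst (_< L) (sym stays) q<L)))
      where
      stays : toℕ (t (toℕ i) ⟨$⟩ʳ proj₂ pt) ≡ q
      stays = trans (t-above (toℕ i) (proj₂ pt) (toℕ<n i) (subst (toℕ i <_) (sym (proj₂ at)) i<q)) (proj₂ at)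

    step-last : toℕ i < L → At pt L a → At (F i pt) L (a + κ-low)
    step-last i<L at = act-At (U i) L κ-low at stays (cbar-last-low i _ stays i<L)
      where
      stays : toℕ (t (toℕ i) ⟨$⟩ʳ proj₂ pt) ≡ L
      stays = trans (t-above (toℕ i) (proj₂ pt) (toℕ<n i) (subst (toℕ i <_) (sym (proj₂ at)) i<L)) (proj₂ at)

  module Orbit (i : Fin n) (κ : ℕ) (wrap : ∀ {pt a} → At pt 0 a → At (F i pt) (toℕ i) (a + κ)) where

    private
      I : ℕ
      I = toℕ i

    descend : ∀ s q {pt a} → s + suc q ≤ I → At pt (s + suc q) a → At (F i ^[ s ] pt) (suc q) a
    descend zero    q bound at = at
    descend (suc s) q {pt} {a} bound at =
      step-down i q (≤-trans (s≤s (m≤n+m (suc q) s)) bound)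
        (descend s (suc q) (subst (_≤ I) (sym (+-suc s (suc q))) bound)
                           (At-pos (sym (+-suc s (suc q))) at))

    to-zero : ∀ q {pt a} → suc q ≤ I → At pt (suc q) a → At (F i ^[ suc q ] pt) 0 (a + 1)
    to-zero q bound at = step-land i (≤-trans (s≤s z≤n) bound)
      (descend q 0 (subst (_≤ I) (sym (+-comm q 1)) bound) (At-pos (sym (+-comm q 1)) at))

    from-top : ∀ s → s ≤ I → ∀ {pt a} → At pt I a → Σ ℕ λ c → At (F i ^[ s ] pt) (I ∸ s) c
    from-top s s≤I {pt} {a} at with m≤n⇒m<n∨m≡n s≤I
    ... | inj₁ s<I = a , At-pos (sym I∸s) (descend s (I ∸ suc s) (≤-reflexive split) (At-pos (sym split) at))
      where
      I∸s : I ∸ s ≡ suc (I ∸ suc s)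
      I∸s = +-∸-assoc 1 s<I
      split : s + suc (I ∸ suc s) ≡ I
      split = trans (cong (s +_) (sym I∸s)) (m+[n∸m]≡n s≤I)
    from-top zero    s≤I {a = a} at | inj₂ _   = a , at
    from-top (suc s) s≤I {a = a} at | inj₂ s≡I =
      a + 1 , At-pos (sym (m≤n⇒m∸n≡0 (≤-reflexive (sym s≡I)))) (to-zero s s≤I (At-pos (sym s≡I) at))

    to-top : ∀ q {pt a} → suc q ≤ I → At pt (suc q) a → At (F i ^[ suc (suc q) ] pt) I (a + 1 + κ)
    to-top q bound at = wrap (to-zero q bound at)

    reach-top : ∀ q → q ≤ I → ∀ {pt a} → At pt q a → Σ ℕ λ c → At (F i ^[ suc q ] pt) I c
    reach-top zero    _     {a = a} at = a + κ , wrap at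
    reach-top (suc q) bound {a = a} at = a + 1 + κ , to-top q bound at

    cycle : 1 ≤ I → ∀ q → q ≤ I → ∀ {pt a} → At pt q a → At (F i ^[ suc I ] pt) q (a + suc κ)
    cycle 1≤I zero    _    {pt} {a} at = At-≋ (≡⇒≋ (reorder a κ))
      (subst (λ z → At z 0 (a + κ + 1)) (sym turn)
        (to-zero (pred I) (≤-reflexive (suc-pred I)) (At-pos (sym (suc-pred I)) (wrap at))))
      where
      instance
        I≢0 : NonZero I
        I≢0 = >-nonZero 1≤I
      turn : F i ^[ suc I ] pt ≡ F i ^[ suc (pred I) ] (F i pt)
      turn = trans (cong (λ w → F i ^[ w ] pt) (trans (cong suc (sym (suc-pred I))) (+-comm 1 (suc (pred I)))))
                   (^[]-+ (F i) (suc (pred I)) 1 pt)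
      reorder : ∀ a κ → a + κ + 1 ≡ a + suc κ
      reorder a κ = trans (+-assoc a κ 1) (cong (a +_) (+-comm κ 1))
    cycle 1≤I (suc q) q<I {pt} {a} at = subst (λ z → At z (suc q) (a + suc κ)) turn
      (descend d q (≤-reflexive d+q+1≡I) (At-pos (sym d+q+1≡I) (At-≋ (≡⇒≋ (+-assoc a 1 κ)) (to-top q q<I at))))
      where
      d : ℕ
      d = I ∸ suc q
      d+q+1≡I : d + suc q ≡ I
      d+q+1≡I = m∸n+n≡m q<I
      turn : F i ^[ d ] (F i ^[ suc (suc q) ] pt) ≡ F i ^[ suc I ] pt
      turn = trans (sym (^[]-+ (F i) d (suc (suc q)) pt))
                   (cong (λ w → F i ^[ w ] pt) (trans (+-suc d (suc q)) (cong suc d+q+1≡I)))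

module Levels (r p α ℓ : ℕ) .{{_ : NonZero r}} where
  open Generators r p α ℓ public

  csum-U : ∀ i v → cbar r p n α i last ≡ ⟦ v ⟧ → csum (U i) ≋ 1 + v
  csum-U i v last≡ = trans (csum-ends (U i) (λ j 0<j j<L → cbar-middle i j 0<j j<L))
    (+-≋ (trans (cong (λ x → toℕ x % r) (cbar-first i fzero refl)) (toℕ-⟦⟧-≋ 1))
         (trans (cong (λ x → toℕ x % r) last≡) (toℕ-⟦⟧-≋ v)))

  at-last : ∀ c → At (⟦ c ⟧ , last) L c
  at-last c = refl , toℕ-fromℕ L

  -- The defect φ(g) = αp·c − (αp − 1)·csum(g) is additive on the stabiliser
  -- of L and vanishes on the lower generators U_0, …, U_{L-1}.
  HasDefect : Elt r n → ℕ → Set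
  HasDefect g v = Σ ℕ λ c → act g (⟦ 0 ⟧ , last) ≡ (⟦ c ⟧ , last) × α * p * c ≋ κ-low * csum g + p * v

  defect-e : HasDefect e 0
  defect-e = 0 , act-e _ , sym (begin
    κ-low * csum e + p * 0  ≈⟨ +-≋ (*-congˡ-≋ {a = κ-low} csum-e) (≡⇒≋ (*-zeroʳ p)) ⟩
    κ-low * 0 + 0           ≡⟨ cong (_+ 0) (*-zeroʳ κ-low) ⟩
    0                       ≡⟨ *-zeroʳ (α * p) ⟨
    α * p * 0               ∎)
    where open ≋-Reasoning

  defect-· : ∀ {g h v w} → HasDefect g v → HasDefect h w → HasDefect (g · h) (v + w)
  defect-· {g} {h} {v} {w} (c , g-moves , g-eq) (d , h-moves , h-eq) = d + c , moves , (begin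
    α * p * (d + c)                                      ≡⟨ *-distribˡ-+ (α * p) d c ⟩
    α * p * d + α * p * c                                ≈⟨ +-≋ h-eq g-eq ⟩
    κ-low * csum h + p * w + (κ-low * csum g + p * v)    ≡⟨ rearrange κ-low (csum g) (csum h) p v w ⟩
    κ-low * (csum g + csum h) + p * (v + w)              ≈⟨ +-≋ (*-congˡ-≋ {a = κ-low} (csum-· g h)) refl ⟨
    κ-low * csum (g · h) + p * (v + w)                   ∎)
    where
    open ≋-Reasoning
    moves : act (g · h) (⟦ 0 ⟧ , last) ≡ (⟦ d + c ⟧ , last)
    moves = trans (act-· g h _) (trans (cong (act g) h-moves) (act-translate g last last d c g-moves))
    rearrange : ∀ k S T q v w → k * T + q * w + (k * S + q * v) ≡ k * (S + T) + q * (v + w)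
    rearrange = solve-∀

  defect-^ : ∀ {g v} k → HasDefect g v → HasDefect (g ^ᴳ k) (k * v)
  defect-^ zero    _ = defect-e
  defect-^ {g} (suc k) d = defect-· {g} {g ^ᴳ k} d (defect-^ k d)

  defect-≈ : ∀ {g h v} → g ≈ᴳ h → HasDefect g v → HasDefect h v
  defect-≈ {g} {h} {v} g≈h (c , moves , eq) =
    c , trans (sym (act-≈ {g} {h} g≈h _)) moves , subst (λ S → α * p * c ≋ κ-low * S + p * v) (csum-≈ {g} {h} g≈h) eq

  defect-low : ∀ i → toℕ i < L → HasDefect (U i) 0
  defect-low i i<L = κ-low , At-unique (step-last i i<L (at-last 0)) (at-last κ-low) refl , (begin
    α * p * κ-low              ≡⟨ *-comm (α * p) κ-low ⟩
    κ-low * (α * p)            ≈⟨ *-congˡ-≋ {a = κ-low} (1+[x-1]≋x (α * p)) ⟨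
    κ-low * (1 + κ-low)        ≈⟨ *-congˡ-≋ {a = κ-low} (csum-U i κ-low (cbar-last-low i last (toℕ-fromℕ L) i<L)) ⟨
    κ-low * csum (U i)         ≡⟨ +-identityʳ _ ⟨
    κ-low * csum (U i) + 0     ≡⟨ cong (κ-low * csum (U i) +_) (*-zeroʳ p) ⟨
    κ-low * csum (U i) + p * 0 ∎)
    where open ≋-Reasoning

  Stab : ℕ → Elt r n → Set
  Stab J g = (∀ j → J ≤ toℕ j → toℕ j < L → act g (⟦ 0 ⟧ , j) ≡ (⟦ 0 ⟧ , j)) × HasDefect g 0

  stab-e : ∀ J → Stab J e
  stab-e J = (λ j _ _ → act-e _) , defect-e

  -- Stab 0 is trivial: all coordinates but the last vanish, and then the
  -- defect equation forces the last one to vanish too.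
  stab-bottom : ∀ {g} → Stab 0 g → g ≈ᴳ e
  stab-bottom {g} (fixes , c , moves , eq) = act⇒≈ {g} {e} λ j → trans (agree j) (sym (act-e _))
    where
    fixed-coord : ∀ j → toℕ j < L → coord g j ≡ ⟦ 0 ⟧
    fixed-coord j j<L = trans (cong (coord g) (sym (cong proj₂ (fixes j z≤n j<L))))
                              (trans (sym (⊕-identityˡ _)) (cong proj₁ (fixes j z≤n j<L)))
    last-coord : coord g last ≡ ⟦ c ⟧
    last-coord = trans (cong (coord g) (sym (cong proj₂ moves))) (trans (sym (⊕-identityˡ _)) (cong proj₁ moves))
    csum≋c : csum g ≋ c
    csum≋c = begin
      csum g                                           ≈⟨ csum-ends g (λ j _ j<L → fixed-coord j j<L) ⟩
      toℕ (coord g fzero) + toℕ (coord g last)         ≡⟨ cong₂ (λ x y → toℕ x + toℕ y) (fixed-coord fzero z<s) last-coord ⟩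
      toℕ ⟦ 0 ⟧ + toℕ ⟦ c ⟧                            ≈⟨ +-≋ (toℕ-⟦⟧-≋ 0) (toℕ-⟦⟧-≋ c) ⟩
      c                                                ∎
      where open ≋-Reasoning
    c≋0 : c ≋ 0
    c≋0 = +-cancelʳ-≋ (κ-low * c) (begin
      c + κ-low * c          ≡⟨⟩
      suc κ-low * c          ≈⟨ *-≋ (1+[x-1]≋x (α * p)) refl ⟩
      α * p * c              ≈⟨ eq ⟩
      κ-low * csum g + p * 0 ≡⟨ cong (κ-low * csum g +_) (*-zeroʳ p) ⟩
      κ-low * csum g + 0     ≈⟨ +-≋ (*-congˡ-≋ {a = κ-low} csum≋c) refl ⟩
      κ-low * c + 0          ≡⟨ +-comm (κ-low * c) 0 ⟩
      0 + κ-low * c          ∎)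
      where open ≋-Reasoning
    agree : ∀ j → act g (⟦ 0 ⟧ , j) ≡ (⟦ 0 ⟧ , j)
    agree j with toℕ j <? L
    ... | yes j<L = fixes j z≤n j<L
    ... | no j≮L  = trans (cong (λ k → act g (⟦ 0 ⟧ , k)) j≡last) (trans moves (cong₂ _,_ (⟦⟧-cong c≋0) (sym j≡last)))
      where
      j≡last : j ≡ last
      j≡last = toℕ-injective (trans (≤-antisym (≤L j) (≮⇒≥ j≮L)) (sym (toℕ-fromℕ L)))

  data Position (I : ℕ) (j : Fin n) : Set where
    below   : toℕ j ≤ I → Position I j
    between : I < toℕ j → toℕ j < L → Position I j
    at-L    : toℕ j ≡ L → Position I j

  position : ∀ I j → Position I j
  position I j with toℕ j ≤? I | toℕ j <? L
  ... | yes j≤I | _       = below j≤I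
  ... | no j≰I  | yes j<L = between (≰⇒> j≰I) j<L
  ... | no _    | no j≮L  = at-L (≤-antisym (≤L j) (≮⇒≥ j≮L))

∸-fixed : ∀ {m} s → s ≤ m → m ∸ s ≡ m → s ≡ 0
∸-fixed zero    _   _  = refl
∸-fixed {m} (suc s) s≤m eq = ⊥-elim (<⇒≢ (∸-monoʳ-< {m} {suc s} {0} z<s s≤m) eq)

module LowerLevels (r p α ℓ : ℕ) .{{_ : NonZero r}} where
  open Levels r p α ℓ public

  -- On the positions
  -- 0, …, I it acts as a cycle of length I + 1 that adds 1 per turn, so the
  -- orbit of base = (0 , I) consists of the (I + 1)·r points at positions ≤ I.
  module Lower (i : Fin n) (i<L : toℕ i < L) where

    private
      I : ℕ
      I = toℕ i

    -- the wrap-around step 0 ↦ I adds 1 for I = 0 (U_0 = (1,0,…;id)) and nothing for I > 0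
    δ : ℕ → ℕ
    δ zero    = 1
    δ (suc _) = 0

    wrap-at : ∀ J → I ≡ J → ∀ {pt a} → At pt 0 a → At (F i pt) I (a + δ J)
    wrap-at zero    I≡0   at = At-pos (sym I≡0) (step-wrap-zero i I≡0 at)
    wrap-at (suc J) I≡J+1 {a = a} at =
      At-≋ (≡⇒≋ (sym (+-identityʳ a))) (step-wrap-middle i (subst (0 <_) (sym I≡J+1) z<s) i<L at)

    open Orbit i (δ I) (wrap-at I refl)

    cycle-low : ∀ q → q ≤ I → ∀ {pt a} → At pt q a → At (F i ^[ suc I ] pt) q (a + 1)
    cycle-low q q≤I {pt} {a} at = go I refl
      where
      go : ∀ J → I ≡ J → At (F i ^[ suc I ] pt) q (a + 1)
      go zero I≡0 = subst (λ k → At (F i ^[ suc k ] pt) q (a + 1)) (sym I≡0)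
        (At-pos (sym (n≤0⇒n≡0 (subst (q ≤_) I≡0 q≤I)))
          (step-wrap-zero i I≡0 (At-pos (n≤0⇒n≡0 (subst (q ≤_) I≡0 q≤I)) at)))
      go (suc J) I≡J+1 = At-≋ (≡⇒≋ (cong (λ k → a + suc (δ k)) I≡J+1))
        (cycle (subst (1 ≤_) (sym I≡J+1) (s≤s z≤n)) q q≤I at)

    order : ℕ
    order = r * suc I

    instance
      order≢0 : NonZero order
      order≢0 = m*n≢0 r (suc I)

    base : Pt
    base = ⟦ 0 ⟧ , i

    at-base : At base I 0
    at-base = refl , refl

    fixed-At : ∀ k {q} → I < q → q < L → ∀ {pt a} → At pt q a → At (F i ^[ k ] pt) q a
    fixed-At k I<q q<L {a = a} at = At-≋ (≡⇒≋ (trans (cong (a +_) (*-zeroʳ k)) (+-identityʳ a)))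
      (iterate-At (F i) 0 (λ {_} {b} at′ → At-≋ (≡⇒≋ (sym (+-identityʳ b))) (step-fixed i _ I<q q<L at′)) k at)

    fixed : ∀ k j → I < toℕ j → toℕ j < L → F i ^[ k ] (⟦ 0 ⟧ , j) ≡ (⟦ 0 ⟧ , j)
    fixed k j I<j j<L = At-unique (fixed-At k I<j j<L (refl , refl)) (refl , refl) refl

    period : ∀ pt → F i ^[ order ] pt ≡ pt
    period (x , j) with position I j
    ... | below j≤I = At-unique
      (subst (λ z → At z (toℕ j) (toℕ x + r * 1)) (sym (^[]-* (F i) r (suc I) _))
        (iterate-At (F i ^[ suc I ]_) 1 (cycle-low _ j≤I) r (At-self x j)))
      (At-self x j) (trans (≡⇒≋ (cong (toℕ x +_) (*-comm r 1))) (+-multiple (toℕ x) 1))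
    ... | between I<j j<L = At-unique (fixed-At order I<j j<L (At-self x j)) (At-self x j) refl
    ... | at-L j≡L = At-unique
      (iterate-At (F i) κ-low (step-last i i<L) order (At-pos j≡L (At-self x j)))
      (At-pos j≡L (At-self x j))
      (trans (≡⇒≋ (cong (toℕ x +_) turns)) (+-multiple (toℕ x) (suc I * κ-low)))
      where
      turns : order * κ-low ≡ suc I * κ-low * r
      turns = trans (cong (_* κ-low) (*-comm r (suc I))) (trans (*-assoc (suc I) r κ-low)
                (trans (cong (suc I *_) (*-comm r κ-low)) (sym (*-assoc (suc I) κ-low r))))

    first-return : ∀ d → d < order → F i ^[ d ] base ≡ base → d ≡ 0
    first-return d d<order returns = begin
      d                   ≡⟨ m≡m%n+[m/n]*n d (suc I) ⟩
      rest + laps * suc I ≡⟨ cong₂ (λ x y → x + y * suc I) rest≡0 laps≡0 ⟩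
      0                   ∎
      where
      open ≡-Reasoning
      rest laps : ℕ
      rest = d % suc I
      laps = d / suc I
      rest≤I : rest ≤ I
      rest≤I = s≤s⁻¹ (m%n<n d (suc I))
      turned : At (F i ^[ laps * suc I ] base) I (laps * 1)
      turned = subst (λ z → At z I (laps * 1)) (sym (^[]-* (F i) laps (suc I) base))
        (iterate-At (F i ^[ suc I ]_) 1 (cycle-low I ≤-refl) laps at-base)
      split : F i ^[ d ] base ≡ F i ^[ rest ] (F i ^[ laps * suc I ] base)
      split = trans (cong (λ k → F i ^[ k ] base) (m≡m%n+[m/n]*n d (suc I))) (^[]-+ (F i) rest (laps * suc I) base)
      rest≡0 : rest ≡ 0
      rest≡0 with from-top rest rest≤I turned
      ... | c , at-rest = ∸-fixed rest rest≤I
        (proj₁ (At-functional (subst (λ z → At z (I ∸ rest) c) (trans (sym split) returns) at-rest) at-base))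
      laps≡0 : laps ≡ 0
      laps≡0 = residue-≡ (m<n*o⇒m/o<n d<order) (>-nonZero⁻¹ r)
        (trans (≡⇒≋ (sym (*-identityʳ laps))) (proj₂ (At-functional (subst (λ z → At z I (laps * 1)) turns-back turned) at-base)))
        where
        turns-back : F i ^[ laps * suc I ] base ≡ base
        turns-back = trans (sym (trans split (cong (λ k → F i ^[ k ] (F i ^[ laps * suc I ] base)) rest≡0))) returns

    reach : ∀ x j → toℕ j ≤ I → Σ ℕ λ k → k < order × F i ^[ k ] base ≡ (x , j)
    reach x j j≤I with reach-top (toℕ j) j≤I (At-self x j)
    ... | c , at-top = orbit-reverse (F i) order period {neg c * suc I + suc (toℕ j)} to-base
      where
      to-base : F i ^[ neg c * suc I + suc (toℕ j) ] (x , j) ≡ base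
      to-base = trans (^[]-+ (F i) (neg c * suc I) (suc (toℕ j)) _) (At-unique
        (subst (λ z → At z I (c + neg c * 1)) (sym (^[]-* (F i) (neg c) (suc I) _))
          (iterate-At (F i ^[ suc I ]_) 1 (cycle-low I ≤-refl) (neg c) at-top))
        at-base (trans (≡⇒≋ (cong (c +_) (*-identityʳ (neg c)))) (+-neg c)))

    base-image : ∀ {g} → Stab (suc I) g → toℕ (perm g ⟨$⟩ʳ i) ≤ I
    base-image {g} (fixes , c , moves , _) with position I (perm g ⟨$⟩ʳ i)
    ... | below j≤I       = j≤I
    ... | between I<j j<L =
      ⊥-elim (<⇒≢ I<j (cong toℕ (perm-injective (perm g) (sym (cong proj₂ (fixes _ I<j j<L))))))
    ... | at-L j≡L        = ⊥-elim (<⇒≢ i<L (trans (cong toℕ i≡last) (toℕ-fromℕ L)))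
      where
      i≡last : i ≡ last
      i≡last = perm-injective (perm g)
        (trans (toℕ-injective (trans j≡L (sym (toℕ-fromℕ L)))) (sym (cong proj₂ moves)))

    private
      stays-in-Stab : ∀ k {h} → HasDefect h 0 → HasDefect ((U i ^ᴳ k) · h) 0
      stays-in-Stab k {h} defect = subst (HasDefect ((U i ^ᴳ k) · h)) (trans (+-identityʳ (k * 0)) (*-zeroʳ k))
        (defect-· {U i ^ᴳ k} {h} (defect-^ k (defect-low i i<L)) defect)

    lower-closed : ∀ k {h} → Stab I h → Stab (suc I) ((U i ^ᴳ k) · h)
    lower-closed k {h} (fixes , defect) = fixes′ , stays-in-Stab k {h} defect
      where
      fixes′ : ∀ j → suc I ≤ toℕ j → toℕ j < L → act ((U i ^ᴳ k) · h) (⟦ 0 ⟧ , j) ≡ (⟦ 0 ⟧ , j)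
      fixes′ j I<j j<L = trans (act-^· (U i) k h _)
        (trans (cong (F i ^[ k ]_) (fixes j (<⇒≤ I<j) j<L)) (fixed k j I<j j<L))

    -- Stab (I + 1) = ⋃_{k < order} U_i^k · Stab I: move the image of base
    -- back to base along the orbit.
    lower-decompose : ∀ {g} → Stab (suc I) g
      → Σ ℕ λ k → k < order × Σ (Elt r n) λ h → Stab I h × ((U i ^ᴳ k) · h) ≈ᴳ g
    lower-decompose {g} g∈@(fixes , defect)
      with k , k<order , k-reaches ← reach (proj₁ (act g base)) (proj₂ (act g base)) (base-image {g} g∈)
      = k , k<order , h , (fixes-h , stays-in-Stab back {g} defect) , recombine
      where
      back : ℕ
      back = order ∸ k
      h : Elt r n
      h = (U i ^ᴳ back) · g
      act-h : ∀ pt → act h pt ≡ F i ^[ back ] (act g pt)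
      act-h pt = act-^· (U i) back g pt
      full-turn : ∀ j k′ → j + k′ ≡ order → ∀ pt → F i ^[ j ] (F i ^[ k′ ] pt) ≡ pt
      full-turn j k′ j+k′≡order pt = trans (sym (^[]-+ (F i) j k′ pt)) (trans (cong (λ w → F i ^[ w ] pt) j+k′≡order) (period pt))
      fixes-h : ∀ j → I ≤ toℕ j → toℕ j < L → act h (⟦ 0 ⟧ , j) ≡ (⟦ 0 ⟧ , j)
      fixes-h j I≤j j<L with m≤n⇒m<n∨m≡n I≤j
      ... | inj₁ I<j = trans (act-h _) (trans (cong (F i ^[ back ]_) (fixes j I<j j<L)) (fixed back j I<j j<L))
      ... | inj₂ I≡j = subst (λ j → act h (⟦ 0 ⟧ , j) ≡ (⟦ 0 ⟧ , j)) (toℕ-injective I≡j)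
        (trans (act-h base) (trans (cong (F i ^[ back ]_) (sym k-reaches)) (full-turn back k (m∸n+n≡m (<⇒≤ k<order)) base)))
      recombine : ((U i ^ᴳ k) · h) ≈ᴳ g
      recombine = act⇒≈ {(U i ^ᴳ k) · h} {g} λ j → trans (act-^· (U i) k h _)
        (trans (cong (F i ^[ k ]_) (act-h _)) (full-turn k back (m+[n∸m]≡n (<⇒≤ k<order)) _))

    -- the exponent is read off from the image of base
    lower-unique : ∀ {k k′ h h′} → k < order → k′ < order → Stab I h → Stab I h′
      → ((U i ^ᴳ k) · h) ≈ᴳ ((U i ^ᴳ k′) · h′) → k ≡ k′
    lower-unique {k} {k′} {h} {h′} k< k′< (fixes , _) (fixes′ , _) eq =
      orbit-injective (F i) (act-injective (U i)) first-return k< k′< (begin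
        F i ^[ k ] base              ≡⟨ cong (F i ^[ k ]_) (fixes i ≤-refl i<L) ⟨
        F i ^[ k ] (act h base)      ≡⟨ act-^· (U i) k h base ⟨
        act ((U i ^ᴳ k) · h) base    ≡⟨ act-≈ {(U i ^ᴳ k) · h} {(U i ^ᴳ k′) · h′} eq base ⟩
        act ((U i ^ᴳ k′) · h′) base  ≡⟨ act-^· (U i) k′ h′ base ⟩
        F i ^[ k′ ] (act h′ base)    ≡⟨ cong (F i ^[ k′ ]_) (fixes′ i ≤-refl i<L) ⟩
        F i ^[ k′ ] base             ∎)
      where open ≡-Reasoning

    lower-order : IsOrder (U i) order
    lower-order = >-nonZero⁻¹ order
      , act⇒≈ {U i ^ᴳ order} {e} (λ j → trans (act-^ (U i) order _) (trans (period _) (sym (act-e _))))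
      , λ d 0<d d<order trivial → <⇒≢ 0<d (sym (first-return d d<order
          (trans (sym (act-^ (U i) d base)) (trans (act-≈ {U i ^ᴳ d} {e} trivial base) (act-e base)))))

-- The transversal for the top generator U_L.  Here r = m·p, and
-- X = n + αp(1 − n) is a unit modulo m with inverse w (1 − n is represented
-- by 1 + (m − 1)·n).
module TopLevel (r p α ℓ m : ℕ) .{{_ : NonZero r}} .{{_ : NonZero p}} .{{_ : NonZero m}}
                (r≡mp : r ≡ m * p) (w : ℕ)
                (X-unit : Mod._≋_ m ((suc (suc ℓ) + α * p * (1 + (m ∸ 1) * suc (suc ℓ))) * w) 1) where

  open LowerLevels r p α ℓ public
  open Scaling m p r r≡mp
  module M = Mod m

  -- the change of the defect under n steps of U_L
  X : ℕ
  X = n + α * p * (1 + (m ∸ 1) * n)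

  p∣r : p ∣ r
  p∣r = divides m r≡mp

  top-at-L : toℕ last ≡ L
  top-at-L = toℕ-fromℕ L

  open Orbit last κ-top (step-wrap-top last top-at-L)

  top-cycle : ∀ q → q ≤ L → ∀ {pt a} → At pt q a → At (F last ^[ n ] pt) q (a + p)
  top-cycle q q≤L {pt} {a} at = subst (λ k → At (F last ^[ suc k ] pt) q (a + p)) top-at-L
    (At-≋ (+-congˡ-≋ {a = a} (1+[x-1]≋x p))
      (cycle (subst (1 ≤_) (sym top-at-L) (s≤s z≤n)) q (subst (q ≤_) (sym top-at-L) q≤L) at))

  top-order : ℕ
  top-order = m * n

  instance
    top-order≢0 : NonZero top-order
    top-order≢0 = m*n≢0 m n

  top-laps : ∀ x q → q ≤ L → ∀ {pt a} → At pt q a → At (F last ^[ x * n ] pt) q (a + x * p)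
  top-laps x q q≤L at = subst (λ z → At z q _) (sym (^[]-* (F last) x n _))
    (iterate-At (F last ^[ n ]_) p (top-cycle q q≤L) x at)

  -- U_L^{mn} = e: mn steps add m·p = r
  top-period : ∀ pt → F last ^[ top-order ] pt ≡ pt
  top-period (x , j) = At-unique (top-laps m (toℕ j) (≤L j) (At-self x j)) (At-self x j)
    (trans (≡⇒≋ (cong (toℕ x +_) (trans (sym r≡mp) (sym (*-identityˡ r))))) (+-multiple (toℕ x) 1))

  -- the coordinates of U_L sum to 1 + (p − 1) = p
  csum-top : csum (U last) ≋ p
  csum-top = trans (csum-U last κ-top (cbar-last-top last last top-at-L top-at-L)) (1+[x-1]≋x p)

  top-closed-G : ∀ k {h} → InG r p n h → InG r p n ((U last ^ᴳ k) · h)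
  top-closed-G k {h} p∣h = ∣-≋ p∣r
    (trans (csum-· (U last ^ᴳ k) h) (+-≋ (trans (csum-^ (U last) k) (*-congˡ-≋ {a = k} csum-top)) refl))
    (∣m∣n⇒∣m+n (n∣m*n k) p∣h)

  -- the defect is determined modulo m (since p·v is taken modulo r = m·p)
  defect-≋ : ∀ {g v v′} → v M.≋ v′ → HasDefect g v → HasDefect g v′
  defect-≋ {g} {v} {v′} v≋v′ (c , moves , eq) = c , moves ,
    trans eq (+-congˡ-≋ {a = κ-low * csum g} (trans (≡⇒≋ (*-comm p v)) (trans (scale v≋v′) (≡⇒≋ (*-comm v′ p)))))

  defect-unique : ∀ {g v v′} → HasDefect g v → HasDefect g v′ → v M.≋ v′
  defect-unique {g} {v} {v′} (c , moves , eq) (c′ , moves′ , eq′) =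
    unscale (trans (≡⇒≋ (*-comm v p)) (trans pv≋pv′ (≡⇒≋ (*-comm p v′))))
    where
    S : ℕ
    S = κ-low * csum g
    c≋c′ : c ≋ c′
    c≋c′ = ⟦⟧-injective (trans (sym (cong proj₁ moves)) (cong proj₁ moves′))
    pv≋pv′ : p * v ≋ p * v′
    pv≋pv′ = +-cancelʳ-≋ S (begin
      p * v + S     ≡⟨ +-comm (p * v) S ⟩
      S + p * v     ≈⟨ eq ⟨
      α * p * c     ≈⟨ *-congˡ-≋ {a = α * p} c≋c′ ⟩
      α * p * c′    ≈⟨ eq′ ⟩
      S + p * v′    ≡⟨ +-comm S (p * v′) ⟩
      p * v′ + S    ∎)
      where open ≋-Reasoning

  -- elements of defect 0 lie in G(r,p,n): modulo p the defect equation
  -- reads csum g ≡ 0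
  defect-in-G : ∀ {g} → HasDefect g 0 → InG r p n g
  defect-in-G {g} (c , _ , eq) = ∣m+n∣m⇒∣n (∣-≋ p∣r congruence p∣αpS) p∣αpc
    where
    S : ℕ
    S = csum g
    p∣αpS : p ∣ α * p * S
    p∣αpS = ∣m⇒∣m*n S (n∣m*n α)
    p∣αpc : p ∣ α * p * c
    p∣αpc = ∣m⇒∣m*n c (n∣m*n α)
    congruence : α * p * c + S ≋ α * p * S
    congruence = begin
      α * p * c + S                ≈⟨ +-≋ eq refl ⟩
      κ-low * S + p * 0 + S        ≡⟨ cong (λ z → κ-low * S + z + S) (*-zeroʳ p) ⟩
      κ-low * S + 0 + S            ≡⟨ cong (_+ S) (+-identityʳ (κ-low * S)) ⟩
      κ-low * S + S                ≡⟨ +-comm (κ-low * S) S ⟩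
      suc κ-low * S                ≈⟨ *-≋ (1+[x-1]≋x (α * p)) refl ⟩
      α * p * S                    ∎
      where open ≋-Reasoning

  defect-exists : ∀ {g y} → act g (⟦ 0 ⟧ , last) ≡ (⟦ y ⟧ , last) → InG r p n g → Σ ℕ (HasDefect g)
  defect-exists {g} {y} moves (divides σ S≡σp) = α * y + M.neg (κ-low * σ) , y , moves , (begin
    α * p * y                                              ≡⟨ +-identityʳ _ ⟨
    α * p * y + 0                                          ≈⟨ +-congˡ-≋ {a = α * p * y} (scale (M.+-neg (κ-low * σ))) ⟨
    α * p * y + (κ-low * σ + M.neg (κ-low * σ)) * p        ≡⟨ rearrange (α) p y κ-low σ (M.neg (κ-low * σ)) ⟩
    κ-low * (σ * p) + p * (α * y + M.neg (κ-low * σ))      ≡⟨ cong (λ S → κ-low * S + p * (α * y + M.neg (κ-low * σ))) S≡σp ⟨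
    κ-low * csum g + p * (α * y + M.neg (κ-low * σ))       ∎)
    where
    open ≋-Reasoning
    rearrange : ∀ a p y k σ z → a * p * y + (k * σ + z) * p ≡ k * (σ * p) + p * (a * y + z)
    rearrange = solve-∀

  -- κ n + X ≡ αp (mod m): this makes X the defect of U_L^n
  X-identity : κ-low * n + X M.≋ α * p
  X-identity = begin
    κ-low * n + X                                        ≡⟨ +-assoc (κ-low * n) n _ ⟨
    κ-low * n + n + α * p * (1 + (m ∸ 1) * n)            ≈⟨ M.+-≋ (reduce κn+n≋αpn) refl ⟩
    α * p * n + α * p * (1 + (m ∸ 1) * n)                ≡⟨ rearrange (α * p) n (m ∸ 1) ⟩
    α * p + α * p * n * (1 + (m ∸ 1))                    ≡⟨ cong (λ z → α * p + α * p * n * z) (m+[n∸m]≡n (>-nonZero⁻¹ m)) ⟩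
    α * p + α * p * n * m                                ≈⟨ M.+-multiple (α * p) (α * p * n) ⟩
    α * p                                                ∎
    where
    open M.≋-Reasoning
    κn+n≋αpn : κ-low * n + n ≋ α * p * n
    κn+n≋αpn = trans (≡⇒≋ (+-comm (κ-low * n) n)) (*-≋ (1+[x-1]≋x (α * p)) refl)
    rearrange : ∀ a n k → a * n + a * (1 + k * n) ≡ a + a * n * (1 + k)
    rearrange = solve-∀

  defect-laps : ∀ x → HasDefect (U last ^ᴳ (x * n)) (x * X)
  defect-laps x = x * p , moves , (begin
    α * p * (x * p)                                    ≡⟨ rearrange₁ (α * p) p x ⟩
    x * (α * p * p)                                    ≈⟨ *-congˡ-≋ {a = x} (scale X-identity) ⟨
    x * ((κ-low * n + X) * p)                          ≡⟨ rearrange₂ x κ-low n X p ⟩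
    κ-low * (x * n * p) + p * (x * X)                  ≈⟨ +-≋ (*-congˡ-≋ {a = κ-low} csum-laps) refl ⟨
    κ-low * csum (U last ^ᴳ (x * n)) + p * (x * X)     ∎)
    where
    open ≋-Reasoning
    moves : act (U last ^ᴳ (x * n)) (⟦ 0 ⟧ , last) ≡ (⟦ x * p ⟧ , last)
    moves = trans (act-^ (U last) (x * n) _) (At-unique (top-laps x L ≤-refl (at-last 0)) (at-last (x * p)) refl)
    csum-laps : csum (U last ^ᴳ (x * n)) ≋ x * n * p
    csum-laps = trans (csum-^ (U last) (x * n)) (*-congˡ-≋ {a = x * n} csum-top)
    rearrange₁ : ∀ a p x → a * (x * p) ≡ x * (a * p)
    rearrange₁ = solve-∀
    rearrange₂ : ∀ x k n X p → x * ((k * n + X) * p) ≡ k * (x * n * p) + p * (x * X)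
    rearrange₂ = solve-∀

  cancel-X : ∀ {x x′} → x * X M.≋ x′ * X → x M.≋ x′
  cancel-X {x} {x′} eq = begin
    x               ≡⟨ *-identityʳ x ⟨
    x * 1           ≈⟨ M.*-congˡ-≋ {a = x} X-unit ⟨
    x * (X * w)     ≡⟨ *-assoc x X w ⟨
    x * X * w       ≈⟨ M.*-≋ eq refl ⟩
    x′ * X * w      ≡⟨ *-assoc x′ X w ⟩
    x′ * (X * w)    ≈⟨ M.*-congˡ-≋ {a = x′} X-unit ⟩
    x′ * 1          ≡⟨ *-identityʳ x′ ⟩
    x′              ∎
    where open M.≋-Reasoning

  clear-defect : ∀ {g y} → act g (⟦ 0 ⟧ , last) ≡ (⟦ y ⟧ , last) → InG r p n g
    → Σ ℕ λ x → x < m × HasDefect ((U last ^ᴳ (x * n)) · g) 0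
  clear-defect {g} moves g∈ = clear (defect-exists {g} moves g∈)
    where
    clear : Σ ℕ (HasDefect g) → Σ ℕ λ x → x < m × HasDefect ((U last ^ᴳ (x * n)) · g) 0
    clear (v , g-defect) = x , m%n<n (M.neg v * w) m ,
      defect-≋ {(U last ^ᴳ (x * n)) · g} clears (defect-· {U last ^ᴳ (x * n)} {g} (defect-laps x) g-defect)
      where
      -- x ≡ −v·X⁻¹ (mod m)
      x : ℕ
      x = M.neg v * w % m
      clears : x * X + v M.≋ 0
      clears = begin
        x * X + v              ≈⟨ M.+-≋ (M.*-≋ (M.%-≋ (M.neg v * w)) refl) refl ⟩
        M.neg v * w * X + v    ≡⟨ cong (_+ v) (trans (*-assoc (M.neg v) w X) (cong (M.neg v *_) (*-comm w X))) ⟩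
        M.neg v * (X * w) + v  ≈⟨ M.+-≋ (M.*-congˡ-≋ {a = M.neg v} X-unit) refl ⟩
        M.neg v * 1 + v        ≡⟨ trans (cong (_+ v) (*-identityʳ (M.neg v))) (+-comm (M.neg v) v) ⟩
        v + M.neg v            ≈⟨ M.+-neg v ⟩
        0                      ∎
        where open M.≋-Reasoning

  decompose-from : ∀ {g} j {y} → 1 ≤ j → j ≤ n → act ((U last ^ᴳ j) · g) (⟦ 0 ⟧ , last) ≡ (⟦ y ⟧ , last)
    → InG r p n g → Σ ℕ λ k → k < top-order × Σ (Elt r n) λ h → Stab L h × ((U last ^ᴳ k) · h) ≈ᴳ g
  decompose-from {g} j 1≤j j≤n moves g∈ =
    assemble (clear-defect {(U last ^ᴳ j) · g} moves (top-closed-G j {g} g∈))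
    where
    assemble : (Σ ℕ λ x → x < m × HasDefect ((U last ^ᴳ (x * n)) · ((U last ^ᴳ j) · g)) 0)
             → Σ ℕ λ k → k < top-order × Σ (Elt r n) λ h → Stab L h × ((U last ^ᴳ k) · h) ≈ᴳ g
    assemble (x , x<m , h-defect) = k , k<order , h , ((λ i L≤i i<L → ⊥-elim (<⇒≱ i<L L≤i)) , h-defect) , recombine
      where
      h : Elt r n
      h = (U last ^ᴳ (x * n)) · ((U last ^ᴳ j) · g)
      steps : ℕ
      steps = x * n + j
      steps≤order : steps ≤ top-order
      steps≤order = begin
        x * n + j   ≤⟨ +-monoʳ-≤ (x * n) j≤n ⟩
        x * n + n   ≡⟨ +-comm (x * n) n ⟩
        suc x * n   ≤⟨ *-monoˡ-≤ n x<m ⟩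
        m * n       ∎
        where open ≤-Reasoning
      k : ℕ
      k = top-order ∸ steps
      k<order : k < top-order
      k<order = ∸-monoʳ-< {top-order} {steps} {0} (≤-trans 1≤j (m≤n+m j (x * n))) steps≤order
      act-h : ∀ pt → act h pt ≡ F last ^[ steps ] (act g pt)
      act-h pt = trans (act-^· (U last) (x * n) ((U last ^ᴳ j) · g) pt)
        (trans (cong (F last ^[ x * n ]_) (act-^· (U last) j g pt)) (sym (^[]-+ (F last) (x * n) j (act g pt))))
      recombine : ((U last ^ᴳ k) · h) ≈ᴳ g
      recombine = act⇒≈ {(U last ^ᴳ k) · h} {g} λ i → trans (act-^· (U last) k h (⟦ 0 ⟧ , i))
        (trans (cong (F last ^[ k ]_) (act-h (⟦ 0 ⟧ , i))) (trans (sym (^[]-+ (F last) k steps (act g (⟦ 0 ⟧ , i))))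
          (trans (cong (λ z → F last ^[ z ] (act g (⟦ 0 ⟧ , i))) (m∸n+n≡m steps≤order)) (top-period (act g (⟦ 0 ⟧ , i))))))

  -- G(r,p,n) = ⋃_{k < mn} U_L^k · Stab L: the last position returns to
  -- itself after at most n steps of U_L, and then the defect is cleared.
  top-decompose : ∀ {g} → InG r p n g
    → Σ ℕ λ k → k < top-order × Σ (Elt r n) λ h → Stab L h × ((U last ^ᴳ k) · h) ≈ᴳ g
  top-decompose {g} g∈ = via (act g (⟦ 0 ⟧ , last)) refl
    where
    via : ∀ pt → act g (⟦ 0 ⟧ , last) ≡ pt
        → Σ ℕ λ k → k < top-order × Σ (Elt r n) λ h → Stab L h × ((U last ^ᴳ k) · h) ≈ᴳ g
    via (x , j) image = returned (reach-top (toℕ j) (subst (toℕ j ≤_) (sym top-at-L) (≤L j)) (At-self x j))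
      where
      returned : (Σ ℕ λ y → At (F last ^[ suc (toℕ j) ] (x , j)) (toℕ last) y)
               → Σ ℕ λ k → k < top-order × Σ (Elt r n) λ h → Stab L h × ((U last ^ᴳ k) · h) ≈ᴳ g
      returned (y , at-top) = decompose-from {g} (suc (toℕ j)) {y} (s≤s z≤n) (toℕ<n j) moves g∈
        where
        moves : act ((U last ^ᴳ suc (toℕ j)) · g) (⟦ 0 ⟧ , last) ≡ (⟦ y ⟧ , last)
        moves = trans (act-^· (U last) (suc (toℕ j)) g (⟦ 0 ⟧ , last))
          (trans (cong (F last ^[ suc (toℕ j) ]_) image) (At-unique (At-pos top-at-L at-top) (at-last y) refl))

  top-image : ∀ s x {P c} → s ≤ L → act P (⟦ 0 ⟧ , last) ≡ (⟦ c ⟧ , last)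
    → Σ ℕ λ c′ → At (act ((U last ^ᴳ (s + x * n)) · P) (⟦ 0 ⟧ , last)) (L ∸ s) c′
  top-image s x {P} {c} s≤L moves = shift (from-top s (subst (s ≤_) (sym top-at-L) s≤L)
                                             (At-pos (sym top-at-L) (top-laps x L ≤-refl (at-last c))))
    where
    image : act ((U last ^ᴳ (s + x * n)) · P) (⟦ 0 ⟧ , last) ≡ F last ^[ s ] (F last ^[ x * n ] (⟦ c ⟧ , last))
    image = trans (act-^· (U last) (s + x * n) P _) (trans (cong (F last ^[ s + x * n ]_) moves) (^[]-+ (F last) s (x * n) _))
    shift : (Σ ℕ λ c′ → At (F last ^[ s ] (F last ^[ x * n ] (⟦ c ⟧ , last))) (toℕ last ∸ s) c′)
          → Σ ℕ λ c′ → At (act ((U last ^ᴳ (s + x * n)) · P) (⟦ 0 ⟧ , last)) (L ∸ s) c′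
    shift (c′ , at) = c′ , At-pos (cong (_∸ s) top-at-L) (subst (λ z → At z (toℕ last ∸ s) c′) (sym image) at)

  split-power : ∀ s t Q pt → act ((U last ^ᴳ (s + t)) · Q) pt ≡ F last ^[ s ] (act ((U last ^ᴳ t) · Q) pt)
  split-power s t Q pt = trans (act-^· (U last) (s + t) Q pt)
    (trans (^[]-+ (F last) s t _) (cong (F last ^[ s ]_) (sym (act-^· (U last) t Q pt))))

  -- the residue of the exponent modulo n is read off from the position of
  -- the image of the last point
  top-residue-unique : ∀ {s s′ x x′ P P′} → s ≤ L → s′ ≤ L → Stab L P → Stab L P′
    → ((U last ^ᴳ (s + x * n)) · P) ≈ᴳ ((U last ^ᴳ (s′ + x′ * n)) · P′) → s ≡ s′
  top-residue-unique {s} {s′} {x} {x′} {P} {P′} s≤L s′≤L (_ , _ , P-moves , _) (_ , _ , P′-moves , _) eq =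
    trans (sym (m∸[m∸n]≡n s≤L)) (trans (cong (L ∸_) L∸s≡L∸s′) (m∸[m∸n]≡n s′≤L))
    where
    image : Σ ℕ λ c → At (act ((U last ^ᴳ (s + x * n)) · P) (⟦ 0 ⟧ , last)) (L ∸ s) c
    image = top-image s x {P} s≤L P-moves
    image′ : Σ ℕ λ c → At (act ((U last ^ᴳ (s′ + x′ * n)) · P′) (⟦ 0 ⟧ , last)) (L ∸ s′) c
    image′ = top-image s′ x′ {P′} s′≤L P′-moves
    L∸s≡L∸s′ : L ∸ s ≡ L ∸ s′
    L∸s≡L∸s′ = proj₁ (At-functional (proj₂ image) (subst (λ z → At z (L ∸ s′) (proj₁ image′))
      (sym (act-≈ {(U last ^ᴳ (s + x * n)) · P} {(U last ^ᴳ (s′ + x′ * n)) · P′} eq (⟦ 0 ⟧ , last))) (proj₂ image′)))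

  top-residue-cancel : ∀ s {x x′ P P′} → ((U last ^ᴳ (s + x * n)) · P) ≈ᴳ ((U last ^ᴳ (s + x′ * n)) · P′)
    → ((U last ^ᴳ (x * n)) · P) ≈ᴳ ((U last ^ᴳ (x′ * n)) · P′)
  top-residue-cancel s {x} {x′} {P} {P′} eq = act⇒≈ {(U last ^ᴳ (x * n)) · P} {(U last ^ᴳ (x′ * n)) · P′} λ j →
    ^[]-injective (F last) (act-injective (U last)) s (begin
      F last ^[ s ] (act ((U last ^ᴳ (x * n)) · P) (⟦ 0 ⟧ , j))     ≡⟨ split-power s (x * n) P (⟦ 0 ⟧ , j) ⟨
      act ((U last ^ᴳ (s + x * n)) · P) (⟦ 0 ⟧ , j)                 ≡⟨ act-≈ {(U last ^ᴳ (s + x * n)) · P} {(U last ^ᴳ (s + x′ * n)) · P′} eq (⟦ 0 ⟧ , j) ⟩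
      act ((U last ^ᴳ (s + x′ * n)) · P′) (⟦ 0 ⟧ , j)               ≡⟨ split-power s (x′ * n) P′ (⟦ 0 ⟧ , j) ⟩
      F last ^[ s ] (act ((U last ^ᴳ (x′ * n)) · P′) (⟦ 0 ⟧ , j))   ∎)
    where open ≡-Reasoning

  -- the number of full turns is read off from the defect, which they change by X
  top-laps-unique : ∀ {x x′ P P′} → x < m → x′ < m → Stab L P → Stab L P′
    → ((U last ^ᴳ (x * n)) · P) ≈ᴳ ((U last ^ᴳ (x′ * n)) · P′) → x ≡ x′
  top-laps-unique {x} {x′} {P} {P′} x<m x′<m (_ , P-defect) (_ , P′-defect) eq =
    M.residue-≡ x<m x′<m (cancel-X (subst₂ M._≋_ (+-identityʳ (x * X)) (+-identityʳ (x′ * X))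
      (defect-unique {(U last ^ᴳ (x′ * n)) · P′}
        (defect-≈ {(U last ^ᴳ (x * n)) · P} {(U last ^ᴳ (x′ * n)) · P′} eq
          (defect-· {U last ^ᴳ (x * n)} {P} (defect-laps x) P-defect))
        (defect-· {U last ^ᴳ (x′ * n)} {P′} (defect-laps x′) P′-defect))))

  top-unique : ∀ {a b P P′} → a < top-order → b < top-order → Stab L P → Stab L P′
    → ((U last ^ᴳ a) · P) ≈ᴳ ((U last ^ᴳ b) · P′) → a ≡ b
  top-unique {a} {b} {P} {P′} a< b< P∈ P′∈ eq = begin
    a                    ≡⟨ m≡m%n+[m/n]*n a n ⟩
    a % n + a / n * n    ≡⟨ cong₂ (λ s x → s + x * n) residues laps ⟩
    b % n + b / n * n    ≡⟨ m≡m%n+[m/n]*n b n ⟨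
    b                    ∎
    where
    open ≡-Reasoning
    eq′ : ((U last ^ᴳ (a % n + a / n * n)) · P) ≈ᴳ ((U last ^ᴳ (b % n + b / n * n)) · P′)
    eq′ = subst₂ (λ u v → ((U last ^ᴳ u) · P) ≈ᴳ ((U last ^ᴳ v) · P′)) (m≡m%n+[m/n]*n a n) (m≡m%n+[m/n]*n b n) eq
    residues : a % n ≡ b % n
    residues = top-residue-unique {a % n} {b % n} {a / n} {b / n} {P} {P′}
      (s≤s⁻¹ (m%n<n a n)) (s≤s⁻¹ (m%n<n b n)) P∈ P′∈ eq′
    laps : a / n ≡ b / n
    laps = top-laps-unique {a / n} {b / n} {P} {P′} (m<n*o⇒m/o<n a<) (m<n*o⇒m/o<n b<) P∈ P′∈
      (top-residue-cancel (a % n) {a / n} {b / n} {P} {P′}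
      (subst (λ s → ((U last ^ᴳ (a % n + a / n * n)) · P) ≈ᴳ ((U last ^ᴳ (s + b / n * n)) · P′)) (sym residues) eq′))

  top-order-is-order : IsOrder (U last) top-order
  top-order-is-order = >-nonZero⁻¹ top-order , full-period , minimal
    where
    full-period : (U last ^ᴳ top-order) ≈ᴳ e
    full-period = act⇒≈ {U last ^ᴳ top-order} {e} λ j →
      trans (act-^ (U last) top-order _) (trans (top-period _) (sym (act-e _)))
    -- a shorter period would give two presentations U_L^d · e = U_L^0 · e
    minimal : ∀ d → 0 < d → d < top-order → ¬ (U last ^ᴳ d) ≈ᴳ e
    minimal d 0<d d< trivial = <⇒≢ 0<d (sym (top-unique {d} {0} {e} {e} d< (>-nonZero⁻¹ top-order) (stab-e L) (stab-e L) same))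
      where
      same : ((U last ^ᴳ d) · e) ≈ᴳ ((U last ^ᴳ 0) · e)
      same = act⇒≈ {(U last ^ᴳ d) · e} {e · e} λ j → begin
        act ((U last ^ᴳ d) · e) (⟦ 0 ⟧ , j)    ≡⟨ act-· (U last ^ᴳ d) e _ ⟩
        act (U last ^ᴳ d) (act e (⟦ 0 ⟧ , j))  ≡⟨ cong (act (U last ^ᴳ d)) (act-e _) ⟩
        act (U last ^ᴳ d) (⟦ 0 ⟧ , j)          ≡⟨ act-≈ {U last ^ᴳ d} {e} trivial _ ⟩
        act e (⟦ 0 ⟧ , j)                      ≡⟨ cong (act e) (act-e _) ⟨
        act e (act e (⟦ 0 ⟧ , j))              ≡⟨ act-· e e _ ⟨
        act (e · e) (⟦ 0 ⟧ , j)                ∎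
        where open ≡-Reasoning

largest : ∀ {Q : ℕ → Set} → Decidable Q → Q 1 → ∀ k → 1 ≤ k
        → Σ ℕ λ d → d ≤ k × Q d × (∀ d′ → d′ ≤ k → Q d′ → d′ ≤ d)
largest Q? q₁ (suc zero)    _ = 1 , ≤-refl , q₁ , λ _ d′≤1 _ → d′≤1
largest {Q} Q? q₁ (suc (suc k)) _ with Q? (suc (suc k)) | largest Q? q₁ (suc k) (s≤s z≤n)
... | yes q  | _ = suc (suc k) , ≤-refl , q , λ _ d′≤k _ → d′≤k
... | no ¬q  | d , d≤k , qd , maximal = d , m≤n⇒m≤1+n d≤k , qd , smaller
  where
  smaller : ∀ d′ → d′ ≤ suc (suc k) → Q d′ → d′ ≤ d
  smaller d′ d′≤k+2 qd′ = maximal d′ (s≤s⁻¹ (≤∧≢⇒< d′≤k+2 λ { refl → ¬q qd′ })) qd′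

prime>1 : ∀ {ℓ} → Prime ℓ → 1 < ℓ
prime>1 {ℓ} pr = nonTrivial⇒n>1 ℓ {{prime⇒nonTrivial pr}}

prime-coprime : ∀ {ℓ a} → Prime ℓ → ¬ ℓ ∣ a → Coprime ℓ a
prime-coprime pr ℓ∤a (d∣ℓ , d∣a) with prime⇒irreducible pr d∣ℓ
... | inj₁ d≡1 = d≡1
... | inj₂ refl = ⊥-elim (ℓ∤a d∣a)

coprime-* : ∀ {a b c} → Coprime a c → Coprime b c → Coprime (a * b) c
coprime-* {a} {b} {c} a⊥c b⊥c {d} (d∣ab , d∣c) = b⊥c (d∣b , d∣c)
  where
  d⊥a : Coprime d a
  d⊥a = gcd≡1⇒coprime (a⊥c (gcd[m,n]∣n d a , ∣-trans (gcd[m,n]∣m d a) d∣c))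
  d∣b : d ∣ b
  d∣b = coprime-divisor d⊥a d∣ab

prime-divisor : ∀ d → .{{NonZero d}} → d ≢ 1 → Σ ℕ λ ℓ → Prime ℓ × ℓ ∣ d
prime-divisor d d≢1 with factorise d
... | record { factors = [] ; isFactorisation = d≡1 } = ⊥-elim (d≢1 d≡1)
... | record { factors = ℓ ∷ ℓs ; isFactorisation = d≡ ; factorsPrime = ℓ-prime ∷ _ } =
  ℓ , ℓ-prime , subst (ℓ ∣_) (sym d≡) (m∣m*n (product ℓs))

coprime-by-primes : ∀ {a b} → .{{NonZero b}} → (∀ {ℓ} → Prime ℓ → ℓ ∣ a → ℓ ∣ b → ⊥) → Coprime a b
coprime-by-primes {a} {b} no-common {d} (d∣a , d∣b) with d ≟ 1
... | yes d≡1 = d≡1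
... | no d≢1 = common-prime (prime-divisor d d≢1)
  where
  instance
    d≢0 : NonZero d
    d≢0 = ≢-nonZero λ { refl → ≢-nonZero⁻¹ b (0∣⇒≡0 d∣b) }
  common-prime : (Σ ℕ λ ℓ → Prime ℓ × ℓ ∣ d) → d ≡ 1
  common-prime (ℓ , ℓ-prime , ℓ∣d) = ⊥-elim (no-common ℓ-prime (∣-trans ℓ∣d d∣a) (∣-trans ℓ∣d d∣b))

coprime⇒unit : ∀ {X m} .{{_ : NonZero m}} → Coprime X m → Σ ℕ λ w → Mod._≋_ m (X * w) 1
coprime⇒unit {X} {m} X⊥m with coprime-Bézout X⊥m
... | Bézout.+- x y 1+ym≡xX = x , trans (≡⇒≋ (trans (*-comm X x) (sym 1+ym≡xX))) (+-multiple 1 y)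
  where open Mod m
... | Bézout.-+ x y 1+xX≡ym = x * (m ∸ 1) , +-cancelʳ-≋ (m ∸ 1) (begin
    X * (x * (m ∸ 1)) + (m ∸ 1)  ≡⟨ rearrange X x (m ∸ 1) ⟩
    (1 + x * X) * (m ∸ 1)         ≡⟨ cong (_* (m ∸ 1)) 1+xX≡ym ⟩
    y * m * (m ∸ 1)               ≡⟨ trans (*-assoc y m (m ∸ 1)) (trans (cong (y *_) (*-comm m (m ∸ 1))) (sym (*-assoc y (m ∸ 1) m))) ⟩
    y * (m ∸ 1) * m               ≈⟨ multiple≋0 (y * (m ∸ 1)) ⟩
    0                             ≈⟨ multiple≋0 1 ⟨
    1 * m                         ≡⟨ trans (*-identityˡ m) (sym (m+[n∸m]≡n (>-nonZero⁻¹ m))) ⟩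
    1 + (m ∸ 1)                   ∎)
  where
  open Mod m
  open ≋-Reasoning
  rearrange : ∀ X x k → X * (x * k) + k ≡ (1 + x * X) * k
  rearrange = solve-∀

-- Let m₁ be the largest divisor of m coprime to n and
-- α = m₁ mod m.  A prime ℓ ∣ m divides α exactly when ℓ ∤ n, so under
-- gcd(n, p, m) = 1 no prime divisor of m divides X = n + αp(1 − n).
module ChooseAlpha (n p m : ℕ) .{{_ : NonZero m}} (gcd≡1 : gcd n (gcd p m) ≡ 1) where

  private
    Q : ℕ → Set
    Q d = d ∣ m × Coprime d n

    Q1 : Q 1
    Q1 = 1∣ m , λ { (d∣1 , _) → ∣1⇒≡1 d∣1 }

    search : Σ ℕ λ d → d ≤ m × Q d × (∀ d′ → d′ ≤ m → Q d′ → d′ ≤ d)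
    search = largest (λ d → (d ∣? m) ×-dec coprime? d n) Q1 m (>-nonZero⁻¹ m)

  m₁ : ℕ
  m₁ = proj₁ search

  m₁∣m : m₁ ∣ m
  m₁∣m = proj₁ (proj₁ (proj₂ (proj₂ search)))

  m₁⊥n : Coprime m₁ n
  m₁⊥n = proj₂ (proj₁ (proj₂ (proj₂ search)))

  -- every prime dividing m but not n divides m₁, else ℓ·m₁ would be larger
  prime∣m₁ : ∀ {ℓ} → Prime ℓ → ℓ ∣ m → ¬ ℓ ∣ n → ℓ ∣ m₁
  prime∣m₁ {ℓ} ℓ-prime ℓ∣m ℓ∤n with ℓ ∣? m₁
  ... | yes ℓ∣m₁ = ℓ∣m₁
  ... | no ℓ∤m₁ = ⊥-elim (<⇒≱ m₁<ℓm₁ (proj₂ (proj₂ (proj₂ search)) (ℓ * m₁) (∣⇒≤ ℓm₁∣m) (ℓm₁∣m , ℓm₁⊥n)))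
    where
    instance
      m₁≢0 : NonZero m₁
      m₁≢0 = ≢-nonZero λ m₁≡0 → ≢-nonZero⁻¹ m (0∣⇒≡0 (subst (_∣ m) m₁≡0 m₁∣m))
    q : ℕ
    q = _∣_.quotient m₁∣m
    ℓ∣q : ℓ ∣ q
    ℓ∣q = coprime-divisor (prime-coprime ℓ-prime ℓ∤m₁) (subst (ℓ ∣_) (trans (_∣_.equality m₁∣m) (*-comm q m₁)) ℓ∣m)
    ℓm₁∣m : ℓ * m₁ ∣ m
    ℓm₁∣m = subst (ℓ * m₁ ∣_) (sym (_∣_.equality m₁∣m)) (*-monoˡ-∣ m₁ ℓ∣q)
    ℓm₁⊥n : Coprime (ℓ * m₁) n
    ℓm₁⊥n = coprime-* (prime-coprime ℓ-prime ℓ∤n) m₁⊥n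
    m₁<ℓm₁ : m₁ < ℓ * m₁
    m₁<ℓm₁ = subst (m₁ <_) (*-comm m₁ ℓ) (m<m*n m₁ ℓ (prime>1 ℓ-prime))

  α : ℕ
  α = m₁ % m

  α<m : α < m
  α<m = m%n<n m₁ m

  X : ℕ
  X = n + α * p * (1 + (m ∸ 1) * n)

  X⊥m : Coprime X m
  X⊥m = coprime-by-primes λ {ℓ} ℓ-prime ℓ∣X ℓ∣m → no-common ℓ-prime ℓ∣X ℓ∣m
    where
    ℓ∣α⇒ℓ∣m₁ : ∀ {ℓ} → ℓ ∣ m → ℓ ∣ α → ℓ ∣ m₁
    ℓ∣α⇒ℓ∣m₁ ℓ∣m ℓ∣α = subst (_ ∣_) (sym (m≡m%n+[m/n]*n m₁ m)) (∣m∣n⇒∣m+n ℓ∣α (∣-trans ℓ∣m (n∣m*n (m₁ / m))))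
    X≡ : X ≡ α * p + n * (1 + (m ∸ 1) * (α * p))
    X≡ = regroup n α p (m ∸ 1)
      where
      regroup : ∀ n α p k → n + α * p * (1 + k * n) ≡ α * p + n * (1 + k * (α * p))
      regroup = solve-∀
    no-common : ∀ {ℓ} → Prime ℓ → ℓ ∣ X → ℓ ∣ m → ⊥
    no-common {ℓ} ℓ-prime ℓ∣X ℓ∣m with ℓ ∣? n
    ... | no ℓ∤n = ℓ∤n (∣m+n∣m⇒∣n (subst (ℓ ∣_) (+-comm n _) ℓ∣X) (∣m⇒∣m*n _ (∣m⇒∣m*n p ℓ∣α)))
      where
      ℓ∣α : ℓ ∣ α
      ℓ∣α = %-presˡ-∣ (prime∣m₁ ℓ-prime ℓ∣m ℓ∤n) ℓ∣m
    ... | yes ℓ∣n with euclidsLemma α p ℓ-prime ℓ∣αp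
      where
      ℓ∣αp : ℓ ∣ α * p
      ℓ∣αp = ∣m+n∣m⇒∣n (subst (ℓ ∣_) (trans X≡ (+-comm (α * p) _)) ℓ∣X) (∣m⇒∣m*n _ ℓ∣n)
    ...   | inj₁ ℓ∣α = <⇒≢ (prime>1 ℓ-prime) (sym (m₁⊥n (ℓ∣α⇒ℓ∣m₁ ℓ∣m ℓ∣α , ℓ∣n)))
    ...   | inj₂ ℓ∣p = <⇒≢ (prime>1 ℓ-prime) (sym (∣1⇒≡1 (subst (ℓ ∣_) gcd≡1 (gcd-greatest ℓ∣n (gcd-greatest ℓ∣p ℓ∣m)))))

  X-unit : Σ ℕ λ w → Mod._≋_ m (X * w) 1
  X-unit = coprime⇒unit X⊥m

module PerfectBasisOfG (r p α ℓ m : ℕ) .{{_ : NonZero r}} .{{_ : NonZero p}} .{{_ : NonZero m}}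
                (r≡mp : r ≡ m * p) (w : ℕ)
                (X-unit : Mod._≋_ m ((suc (suc ℓ) + α * p * (1 + (m ∸ 1) * suc (suc ℓ))) * w) 1) where

  open TopLevel r p α ℓ m r≡mp w X-unit
  open Chain r n

  Level : ℕ → Elt r n → Set
  Level zero    = InG r p n
  Level (suc k) = Stab (L ∸ k)

  -- the (k+1)-st generator of 𝐮 is the lower generator U_{L-1-k}
  module Lower-at (k : Fin L) where
    I : Fin n
    I = inject₁ (opposite k)

    I≡ : toℕ I ≡ L ∸ suc (toℕ k)
    I≡ = trans (toℕ-inject₁ (opposite k)) (opposite-prop k)

    I<L : toℕ I < L
    I<L = subst (_< L) (sym (toℕ-inject₁ (opposite k))) (toℕ<n (opposite k))

    level-below : L ∸ suc (toℕ k) ≡ toℕ I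
    level-below = sym I≡

    level-above : L ∸ toℕ k ≡ suc (toℕ I)
    level-above = trans (+-∸-assoc 1 (toℕ<n k)) (cong suc (sym I≡))

    open LowerLevels.Lower r p α ℓ I I<L public

  orders : Fin n → ℕ
  orders fzero    = top-order
  orders (fsuc k) = Lower-at.order k

  chain : IsChain (𝐮 r p n α) orders Level
  chain = record
    { bottom-e        = subst (λ J → Stab J e) (sym (n∸n≡0 L)) (stab-e 0)
    ; bottom          = λ {g} g∈ → stab-bottom {g} (subst (λ J → Stab J g) (n∸n≡0 L) g∈)
    ; closed          = closed
    ; decompose       = decompose
    ; exponent-unique = unique
    }
    where
    closed : ∀ i k {h} → Level (suc (toℕ i)) h → Level (toℕ i) ((𝐮 r p n α i ^ᴳ k) · h)
    closed fzero    k {h} h∈ = top-closed-G k {h} (defect-in-G {h} (proj₂ h∈))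
    closed (fsuc i) k {h} h∈ = subst (λ J → Stab J ((U I ^ᴳ k) · h)) (sym level-above)
      (lower-closed k {h} (subst (λ J → Stab J h) level-below h∈))
      where open Lower-at i
    decompose : ∀ i {g} → Level (toℕ i) g →
      Σ ℕ λ k → k < orders i × Σ (Elt r n) λ h → Level (suc (toℕ i)) h × ((𝐮 r p n α i ^ᴳ k) · h) ≈ᴳ g
    decompose fzero {g} g∈ = top-decompose {g} g∈
    decompose (fsuc i) {g} g∈ = relabel (lower-decompose {g} (subst (λ J → Stab J g) level-above g∈))
      where
      open Lower-at i
      relabel : (Σ ℕ λ k → k < order × Σ (Elt r n) λ h → Stab (toℕ I) h × ((U I ^ᴳ k) · h) ≈ᴳ g)
              → Σ ℕ λ k → k < order × Σ (Elt r n) λ h → Stab (L ∸ suc (toℕ i)) h × ((U I ^ᴳ k) · h) ≈ᴳ g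
      relabel (k , k< , h , h∈ , eq) = k , k< , h , subst (λ J → Stab J h) (sym level-below) h∈ , eq
    unique : ∀ i {k k′ h h′} → k < orders i → k′ < orders i
      → Level (suc (toℕ i)) h → Level (suc (toℕ i)) h′
      → ((𝐮 r p n α i ^ᴳ k) · h) ≈ᴳ ((𝐮 r p n α i ^ᴳ k′) · h′) → k ≡ k′
    unique fzero {k} {k′} {h} {h′} k< k′< h∈ h′∈ eq = top-unique {k} {k′} {h} {h′} k< k′< h∈ h′∈ eq
    unique (fsuc i) {h = h} {h′} k< k′< h∈ h′∈ eq =
      lower-unique {_} {_} {h} {h′} k< k′< (subst (λ J → Stab J h) level-below h∈) (subst (λ J → Stab J h′) level-below h′∈) eq
      where open Lower-at i

  perfect-basis : IsPerfectBasis (InG r p n) (𝐮 r p n α)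
  perfect-basis = orders , is-order , member ,
    λ g g∈ → presentation-exists chain {g} g∈ ,
             λ k k′ k< k′< k≈g k′≈g → presentation-unique chain {k} {k′} k< k′<
               (≈-trans {present (𝐮 r p n α) k} {g} {present (𝐮 r p n α) k′} k≈g (≈-sym {present (𝐮 r p n α) k′} {g} k′≈g))
    where
    is-order : ∀ i → IsOrder (𝐮 r p n α i) (orders i)
    is-order fzero    = top-order-is-order
    is-order (fsuc i) = Lower-at.lower-order i
    member : ∀ i → InG r p n (𝐮 r p n α i)
    member fzero    = ∣-≋ p∣r csum-top (divides 1 (sym (*-identityˡ p)))
    member (fsuc i) = defect-in-G {U (Lower-at.I i)} (defect-low (Lower-at.I i) (Lower-at.I<L i))

theorem3p3 : (n r p : ℕ) → 2 ≤ n → .{{_ : NonZero r}} → .{{_ : NonZero p}}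
    → p ∣ r → gcd n (gcd p (r / p)) ≡ 1
    → Σ ℕ λ α → (α < r / p) × IsPerfectBasis (InG r p n) (𝐮 r p n α)
theorem3p3 (suc (suc ℓ)) r p (s≤s (s≤s z≤n)) p∣r gcd≡1 =
  α , α<m , PerfectBasisOfG.perfect-basis r p α ℓ m r≡mp (proj₁ X-unit) (proj₂ X-unit)
  where
  m : ℕ
  m = r / p
  r≡mp : r ≡ m * p
  r≡mp = sym (m/n*n≡m p∣r)
  instance
    m≢0 : NonZero m
    m≢0 = ≢-nonZero λ m≡0 → ≢-nonZero⁻¹ r (trans r≡mp (cong (_* p) m≡0))
  open ChooseAlpha (suc (suc ℓ)) p m gcd≡1
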